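{- For every integer $n\ge0$, $(\mathbf{E}^+_\infty)^{\Gamma_k\text{ - }\mathrm{sh},k-n} = \mathbf{E}^+_n$.
   Context: $E$ is a field of characteristic $p$; $\mathbf{E}^+_n=E[[X^{1/p^n}]]$, $\mathbf{E}^+_\infty=\bigcup_{n\ge0}\mathbf{E}^+_n$, with $X$-adic valuation $\operatorname{val}_X$ ($\operatorname{val}_X(X)=1$). $\mathbf{Z}_p^\times$ acts on each $\mathbf{E}^+_n$ by $E$-algebra automorphisms determined by $a\cdot X^{1/p^n}=(1+X^{1/p^n})^a-1$, compatibly in $n$. $k\ge1$ ($k\ge2$ if $p=2$), $\Gamma_k=1+p^k\mathbf{Z}_p$ with coordinate $c(1+p^ka)=a$. For $\lambda\in\mathbf{R}$, $(\mathbf{E}^+_\infty)^{\Gamma_k\text{ - }\mathrm{sh},\lambda}$ is the set of $f\in\mathbf{E}^+_\infty$ for which there is $\mu\in\mathbf{R}$ with $\operatorname{val}_X(c^{ -1}(x)\cdot f-c^{ -1}(y)\cdot f)\ge p^\lambda p^i+\mu$ for all $x,y\in\mathbf{Z}_p$ and integers $i\ge0$ with $\operatorname{val}_p(x-y)\ge i$. -}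

module Defs where

open import Level using (Level; _⊔_) renaming (suc to lsuc)
open import Algebra.Bundles using (CommutativeRing)
open import Data.Nat as ℕ using (ℕ; zero; suc; _^_; NonZero; _%_)
open import Data.Nat.Divisibility using (_∣_)
open import Data.Nat.Properties using (m^n≢0)
open import Data.Nat.Primality using (Prime; prime⇒nonZero)
open import Data.Nat.Combinatorics using (_C_)
open import Data.Fin using (Fin; toℕ)
open import Data.Integer as ℤ using (ℤ; +_; -[1+_])
open import Data.Rational as ℚ using (ℚ; _/_)
open import Data.Product using (∃; Σ)
open import Relation.Nullary using (¬_)
open import Relation.Binary.PropositionalEquality using (_≡_)

record Field (c ℓ : Level) : Set (lsuc (c ⊔ ℓ)) where
  field
    commutativeRing : CommutativeRing c ℓ
  open CommutativeRing commutativeRing public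
  field
    1≉0     : ¬ (1# ≈ 0#)
    inverse : ∀ x → ¬ (x ≈ 0#) → ∃ λ y → (x * y) ≈ 1#

module _ {c ℓ} (F : Field c ℓ) where
  open Field F

  ι : ℕ → Carrier
  ι zero    = 0#
  ι (suc n) = 1# + ι n

  -- F has characteristic p (p prime, so this means char F = p)
  HasChar : ℕ → Set ℓ
  HasChar p = ι p ≈ 0#

  Series : Set c
  Series = ℕ → Carrier

  sumLt : (ℕ → Carrier) → ℕ → Carrier
  sumLt g zero    = 0#
  sumLt g (suc n) = sumLt g n + g n

  oneS : Series
  oneS zero    = 1#
  oneS (suc _) = 0#

  mulS : Series → Series → Series
  mulS f g N = sumLt (λ i → f i * g (N ℕ.∸ i)) (suc N)

  powS : Series → ℕ → Series
  powS g zero    = oneS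
  powS g (suc j) = mulS g (powS g j)

  -- f(g(T)), for g with zero constant term
  compS : Series → Series → Series
  compS f g N = sumLt (λ j → f j * powS g j N) (suc N)

  -- (1+T)^a - 1 for a p-adic integer a, given through its truncations
  -- t r = a mod p^r.  Coefficient of T^j (j ≥ 1) is binom(a, j) mod p,
  -- which equals binom(a mod p^(j+1), j) mod p since p^(j+1) > j.
  onePlusTPowMinusOne : (ℕ → ℕ) → Series
  onePlusTPowMinusOne t zero    = 0#
  onePlusTPowMinusOne t (suc j) = ι (t (suc (suc j)) C suc j)

  actS : (ℕ → ℕ) → Series → Series
  actS t f = compS f (onePlusTPowMinusOne t)

  -- Elements of E^+_∞ = ⋃_m E[[X^(1/p^m)]]: a level m and the
  -- coefficients, coeff j being the coefficient of X^(j/p^m).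
  record Einf : Set c where
    constructor mkEinf
    field
      level : ℕ
      coeff : Series
  open Einf public

  module _ (p : ℕ) (pr : Prime p) where
    private
      instance
        p≢0 : NonZero p
        p≢0 = prime⇒nonZero pr
      pow≢0 : ∀ r → NonZero (p ^ r)
      pow≢0 r = m^n≢0 p r

    -- Z_p, as sequences of p-adic digits: x = Σ x_i p^i
    Zp : Set
    Zp = ℕ → Fin p

    trunc : ℕ → Zp → ℕ
    trunc zero    x = 0
    trunc (suc r) x = trunc r x ℕ.+ toℕ (x r) ℕ.* p ^ r

    -- truncations of c⁻¹(x) = 1 + p^k x, i.e. r ↦ (1 + p^k x) mod p^r
    cinv : ℕ → Zp → ℕ → ℕ
    cinv k x r = _%_ (1 ℕ.+ p ^ k ℕ.* trunc r x) (p ^ r) {{pow≢0 r}}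

    -- val_p(x - y) ≥ i
    ValpDiffGe : Zp → Zp → ℕ → Set
    ValpDiffGe x y i = ∀ t → t ℕ.< i → x t ≡ y t

    ppow : ℤ → ℚ
    ppow (+ n)      = _/_ (+ (p ^ n)) 1
    ppow -[1+ n ]   = _/_ (+ 1) (p ^ suc n) {{pow≢0 (suc n)}}

    -- val_X(s) ≥ r for s ∈ E[[X^(1/p^m)]]
    ValXGe : ℕ → Series → ℚ → Set ℓ
    ValXGe m s r = ∀ j → _/_ (+ j) (p ^ m) {{pow≢0 m}} ℚ.< r → s j ≈ 0#

    InSh : ℕ → ℤ → Einf → Set ℓ
    InSh k λ′ f = Σ ℚ λ μ → ∀ (x y : Zp) (i : ℕ) → ValpDiffGe x y i →
      ValXGe (level f)
        (λ j → actS (cinv k x) (coeff f) j - actS (cinv k y) (coeff f) j)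
        (ppow λ′ ℚ.* ppow (+ i) ℚ.+ μ)

    InE : ℕ → Einf → Set ℓ
    InE n f = ∀ j → ¬ (p ^ level f ∣ j ℕ.* p ^ n) → coeff f j ≈ 0#

-- Write T = X^(1/p^m) for the level m of f; a ∈ ℤ_p acts by T ↦ (1+T)^a − 1.
-- If f ∈ E_n, only powers of T^Q with Q = p^(m−n) occur. When x ≡ y mod p^i, the
-- substitutions for c⁻¹(x) and c⁻¹(y) agree modulo T^(p^(k+i)); by Frobenius their
-- Q-th powers agree modulo T^(Q p^(k+i)), i.e. to X-adic order p^(k−n+i), so the
-- shift condition holds with μ = 0.
-- Conversely compare x = 0 with y = p^i: c⁻¹(y) = 1 + N with N = p^(k+i) substitutes
-- ψ = T(1 + T^(N−1) + T^N). If f only involves powers of T^q, q = p^e, e < m − n, the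
-- coefficient of T^(q(j+N)) in f∘ψ − f is (j+1) f_(q(j+1)) + j f_(qj). For i large
-- this degree lies below the shift bound, so these vanish, and induction on j kills
-- f_(qj) for p ∤ j. Thus f only involves powers of T^(pq); after m − n steps, f ∈ E_n.

module Submission where

open import Data.Nat as ℕ using (ℕ; zero; suc; _≤_; _<_; z≤n; s≤s; _∸_; NonZero)
import Data.Nat.Properties as ℕP
open import Data.Nat.Combinatorics using (_C_; nCk+nC[k+1]≡[n+1]C[k+1]; nC1≡n; nCn≡1)
open import Data.Nat.Divisibility using (_∣_; _∣?_; divides; ∣⇒≤; 1∣_; *-cancelʳ-∣; *-monoˡ-∣; ∣n⇒∣m*n)
open import Data.Nat.Primality using (Prime; euclidsLemma; prime⇒nonZero; prime⇒nonTrivial; prime⇒irreducible)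
open import Data.Nat.Base using (nonTrivial⇒n>1)
open import Data.Nat.DivMod using (_%_; _/_; m≡m%n+[m/n]*n)
open import Data.Nat.Tactic.RingSolver using (solve-∀)
open import Data.Product using (_,_; ∃; proj₁; proj₂)
open import Data.Nat.Coprimality using (Coprime; coprime-Bézout)
open import Data.Nat.GCD using (module Bézout)
open import Data.Sum using (inj₁; inj₂; [_,_]′)
open import Data.Empty using (⊥-elim)
open import Function using (_∘_)
open import Function.Bundles using (_⇔_; mk⇔; Equivalence)
open import Algebra.Bundles using (CommutativeSemiring)
open import Algebra.Structures using (IsCommutativeMonoid)
open import Algebra.Structures.Biased using (isCommutativeSemiringˡ)
open import Relation.Binary.Structures using (IsEquivalence)
open import Relation.Binary.PropositionalEquality as P using (_≡_)
open import Relation.Nullary using (¬_; Dec; yes; no)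
open import Defs

module Arithmetic where
  open import Data.Nat using (_+_; _*_; _^_)
  open import Data.Product using (_×_)

  [1+k]*[1+n]C[1+k]≡[1+n]*nCk : ∀ n k → suc k * (suc n C suc k) ≡ suc n * (n C k)
  [1+k]*[1+n]C[1+k]≡[1+n]*nCk zero    zero    = P.refl
  [1+k]*[1+n]C[1+k]≡[1+n]*nCk zero    (suc k) = ℕP.*-zeroʳ (suc (suc k))
  [1+k]*[1+n]C[1+k]≡[1+n]*nCk (suc n) zero    =
    P.trans (ℕP.*-identityˡ _) (P.trans (nC1≡n (suc (suc n))) (P.sym (ℕP.*-identityʳ _)))
  [1+k]*[1+n]C[1+k]≡[1+n]*nCk (suc n) (suc k) = begin
    suc (suc k) * (suc (suc n) C suc (suc k))
      ≡⟨ P.cong (suc (suc k) *_) (nCk+nC[k+1]≡[n+1]C[k+1] (suc n) (suc k)) ⟨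
    suc (suc k) * (a + b)
      ≡⟨ regroup k a b ⟩
    (suc k * a + a) + suc (suc k) * b
      ≡⟨ P.cong₂ (λ u v → (u + a) + v) ([1+k]*[1+n]C[1+k]≡[1+n]*nCk n k) ([1+k]*[1+n]C[1+k]≡[1+n]*nCk n (suc k)) ⟩
    (suc n * (n C k) + a) + suc n * (n C suc k)
      ≡⟨ collect (suc n) (n C k) a (n C suc k) ⟩
    suc n * (n C k + n C suc k) + a
      ≡⟨ P.cong (λ u → suc n * u + a) (nCk+nC[k+1]≡[n+1]C[k+1] n k) ⟩
    suc n * a + a
      ≡⟨ ℕP.+-comm (suc n * a) a ⟩
    suc (suc n) * a ∎
    where
    open P.≡-Reasoning
    a : ℕ
    a = suc n C suc k
    b : ℕ
    b = suc n C suc (suc k)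
    regroup : ∀ k a b → suc (suc k) * (a + b) ≡ (suc k * a + a) + suc (suc k) * b
    regroup = solve-∀
    collect : ∀ m x a y → (m * x + a) + m * y ≡ m * (x + y) + a
    collect = solve-∀

  p∣pCk : ∀ {p k} → Prime p → 0 < k → k < p → p ∣ p C k
  p∣pCk {suc p} {suc k} pr _ k<p
    with euclidsLemma (suc k) (suc p C suc k) pr
           (divides (p C k) (P.trans ([1+k]*[1+n]C[1+k]≡[1+n]*nCk p k) (ℕP.*-comm (suc p) _)))
  ... | inj₁ p∣k  = ⊥-elim (ℕP.<⇒≱ k<p (∣⇒≤ p∣k))
  ... | inj₂ p∣pCk = p∣pCk

  n<m^n : ∀ {m} → 1 < m → ∀ n → n < m ^ n
  n<m^n 1<m zero    = s≤s z≤n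
  n<m^n {m} 1<m (suc n) = ℕP.≤-<-trans (n<m^n 1<m n) m^n<m^[1+n]
    where
    m^n<m^[1+n] : m ^ n < m ^ suc n
    m^n<m^[1+n] = ℕP.^-monoʳ-< m 1<m (ℕP.n<1+n n)

  ^-∸-split : ∀ p {m n} → n ≤ m → p ^ (m ∸ n) * p ^ n ≡ p ^ m
  ^-∸-split p {m} {n} n≤m = P.trans (P.sym (ℕP.^-distribˡ-+-* p (m ∸ n) n)) (P.cong (p ^_) (ℕP.m∸n+n≡m n≤m))

  p^m∣p^n : ∀ p {m n} → m ≤ n → p ^ m ∣ p ^ n
  p^m∣p^n p {m} {n} m≤n = divides (p ^ (n ∸ m)) (P.sym (^-∸-split p m≤n))

  p^m∣l*p^n⇔p^[m∸n]∣l : ∀ p .{{_ : NonZero p}} m n l → p ^ m ∣ l * p ^ n ⇔ p ^ (m ∸ n) ∣ l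
  p^m∣l*p^n⇔p^[m∸n]∣l p m n l with ℕP.≤-total n m
  ... | inj₁ n≤m = mk⇔
    (λ d → *-cancelʳ-∣ (p ^ n) {{ℕP.m^n≢0 p n}} (P.subst (_∣ l * p ^ n) (P.sym (^-∸-split p n≤m)) d))
    (λ d → P.subst (_∣ l * p ^ n) (^-∸-split p n≤m) (*-monoˡ-∣ (p ^ n) d))
  ... | inj₂ m≤n = mk⇔
    (λ _ → P.subst (_∣ l) (P.cong (p ^_) (P.sym (ℕP.m≤n⇒m∸n≡0 m≤n))) (1∣ l))
    (λ _ → ∣n⇒∣m*n l (p^m∣p^n p m≤n))

  l*p^n<a*p^m⇒l<p^[m∸n]*a : ∀ p .{{_ : NonZero p}} m n l a → l * p ^ n < a * p ^ m → l < p ^ (m ∸ n) * a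
  l*p^n<a*p^m⇒l<p^[m∸n]*a p m n l a h with ℕP.≤-total n m
  ... | inj₁ n≤m = ℕP.*-cancelʳ-< (p ^ n) l _ (P.subst (l * p ^ n <_) regroup h)
    where
    open P.≡-Reasoning
    regroup : a * p ^ m ≡ p ^ (m ∸ n) * a * p ^ n
    regroup = begin
      a * p ^ m                 ≡⟨ P.cong (a *_) (^-∸-split p n≤m) ⟨
      a * (p ^ (m ∸ n) * p ^ n) ≡⟨ ℕP.*-assoc a _ _ ⟨
      a * p ^ (m ∸ n) * p ^ n   ≡⟨ P.cong (_* p ^ n) (ℕP.*-comm a _) ⟩
      p ^ (m ∸ n) * a * p ^ n   ∎
  ... | inj₂ m≤n = P.subst (l <_) (P.sym (P.trans (P.cong (λ z → p ^ z * a) (ℕP.m≤n⇒m∸n≡0 m≤n)) (ℕP.*-identityˡ a)))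
                     (ℕP.*-cancelʳ-< (p ^ n) l a (ℕP.<-≤-trans h (ℕP.*-monoʳ-≤ a (ℕP.^-monoʳ-≤ p m≤n))))

  m<o∸n⇒m+n<o : ∀ m n o → m < o ∸ n → m + n < o
  m<o∸n⇒m+n<o m n o m<o∸n with ℕP.≤-total n o
  ... | inj₁ n≤o = ℕP.m≤o∸n⇒m+n≤o (suc m) n≤o m<o∸n
  ... | inj₂ o≤n = ⊥-elim (ℕP.n≮0 (P.subst (m <_) (ℕP.m≤n⇒m∸n≡0 o≤n) m<o∸n))

  p^u*[j+N]+c<N*p^m : ∀ {p} → 1 < p → ∀ {u m} → u < m → ∀ j c N → suc (j + c) ≤ N → p ^ u * (j + N) + c < N * p ^ m
  p^u*[j+N]+c<N*p^m {p} 1<p {u} {m} u<m j c N j+c<N = begin-strict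
    p ^ u * (j + N) + c     ≡⟨ shuffle (p ^ u) j N c ⟩
    (p ^ u * j + c) + N * p ^ u <⟨ ℕP.+-monoˡ-< (N * p ^ u) small ⟩
    N * p ^ u + N * p ^ u   ≡⟨ double N (p ^ u) ⟩
    N * (2 * p ^ u)         ≤⟨ ℕP.*-monoʳ-≤ N (ℕP.*-monoˡ-≤ (p ^ u) 1<p) ⟩
    N * (p * p ^ u)         ≤⟨ ℕP.*-monoʳ-≤ N (ℕP.^-monoʳ-≤ p {{nz}} u<m) ⟩
    N * p ^ m               ∎
    where
    open ℕP.≤-Reasoning
    nz : NonZero p
    nz = ℕ.>-nonZero (ℕP.<-trans (s≤s z≤n) 1<p)
    1≤p^u : 1 ≤ p ^ u
    1≤p^u = ℕP.m^n>0 p {{nz}} u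
    shuffle : ∀ q j N c → q * (j + N) + c ≡ (q * j + c) + N * q
    shuffle = solve-∀
    double : ∀ N q → N * q + N * q ≡ N * (2 * q)
    double = solve-∀
    collect : ∀ q j c → q + (q * j + c * q) ≡ suc (j + c) * q
    collect = solve-∀
    small : p ^ u * j + c < N * p ^ u
    small = begin-strict
      p ^ u * j + c             <⟨ s≤s (ℕP.+-monoʳ-≤ (p ^ u * j) (ℕP.m≤m*n c (p ^ u) {{ℕ.>-nonZero 1≤p^u}})) ⟩
      suc (p ^ u * j + c * p ^ u) ≤⟨ ℕP.+-monoˡ-≤ _ 1≤p^u ⟩
      p ^ u + (p ^ u * j + c * p ^ u) ≡⟨ collect (p ^ u) j c ⟩
      suc (j + c) * p ^ u       ≤⟨ ℕP.*-monoˡ-≤ (p ^ u) j+c<N ⟩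
      N * p ^ u                 ∎


  large-shift : ∀ {p} → 1 < p → ∀ k e n {m} → e + n < m → ∀ j c →
    let N = p ^ (k + (3 + (j + c))) in 2 + j < N × p ^ e * (j + N) * p ^ n + c < N * p ^ m
  large-shift {p} 1<p k e n {m} e+n<m j c = 2+j<N , within-bound
    where
    i N : ℕ
    i = 3 + (j + c)
    N = p ^ (k + i)
    i≤N : i ≤ N
    i≤N = ℕP.<⇒≤ (ℕP.<-≤-trans (n<m^n 1<p i) (ℕP.^-monoʳ-≤ p {{ℕ.>-nonZero (ℕP.<-trans (s≤s z≤n) 1<p)}} (ℕP.m≤n+m i k)))
    2+j<N : 2 + j < N
    2+j<N = ℕP.<-≤-trans (s≤s (s≤s (s≤s (ℕP.m≤m+n j c)))) i≤N
    within-bound : p ^ e * (j + N) * p ^ n + c < N * p ^ m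
    within-bound = P.subst (λ z → z + c < N * p ^ m) regroup
      (p^u*[j+N]+c<N*p^m 1<p e+n<m j c N (ℕP.≤-trans (ℕP.n≤1+n _) (ℕP.≤-trans (ℕP.n≤1+n _) i≤N)))
      where
      regroup : p ^ (e + n) * (j + N) ≡ p ^ e * (j + N) * p ^ n
      regroup = P.trans (P.cong (_* (j + N)) (ℕP.^-distribˡ-+-* p e n)) (swap (p ^ e) (p ^ n) (j + N))
        where
        swap : ∀ a b x → a * b * x ≡ a * x * b
        swap = solve-∀

open Arithmetic

module PowerSeries {c ℓ} (F : Field c ℓ) where
  open Field F
  open import Relation.Binary.Reasoning.Setoid setoid
  open import Algebra.Properties.CommutativeSemigroup +-commutativeSemigroup using (interchange)
  open import Algebra.Properties.Ring ring using (+-cancelʳ)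

  Σ< : (ℕ → Carrier) → ℕ → Carrier
  Σ< = sumLt F

  sumLt-cong : ∀ {g h : ℕ → Carrier} n → (∀ i → i < n → g i ≈ h i) → Σ< g n ≈ Σ< h n
  sumLt-cong zero    e = refl
  sumLt-cong (suc n) e = +-cong (sumLt-cong n (λ i i<n → e i (ℕP.m<n⇒m<1+n i<n))) (e n ℕP.≤-refl)

  sumLt-zero : ∀ {g : ℕ → Carrier} n → (∀ i → i < n → g i ≈ 0#) → Σ< g n ≈ 0#
  sumLt-zero n e = trans (sumLt-cong n e) (zero≈ n)
    where
    zero≈ : ∀ n → Σ< (λ _ → 0#) n ≈ 0#
    zero≈ zero    = refl
    zero≈ (suc n) = trans (+-identityʳ _) (zero≈ n)

  sumLt-+ : ∀ (g h : ℕ → Carrier) n → Σ< (λ i → g i + h i) n ≈ Σ< g n + Σ< h n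
  sumLt-+ g h zero    = sym (+-identityˡ 0#)
  sumLt-+ g h (suc n) = trans (+-congʳ (sumLt-+ g h n)) (interchange _ _ _ _)

  *-distribˡ-sumLt : ∀ a (g : ℕ → Carrier) n → Σ< (λ i → a * g i) n ≈ a * Σ< g n
  *-distribˡ-sumLt a g zero    = sym (zeroʳ a)
  *-distribˡ-sumLt a g (suc n) = trans (+-congʳ (*-distribˡ-sumLt a g n)) (sym (distribˡ a _ _))

  *-distribʳ-sumLt : ∀ a (g : ℕ → Carrier) n → Σ< (λ i → g i * a) n ≈ Σ< g n * a
  *-distribʳ-sumLt a g n = trans (sumLt-cong n (λ i _ → *-comm _ _)) (trans (*-distribˡ-sumLt a g n) (*-comm _ _))

  sumLt-head : ∀ (g : ℕ → Carrier) n → Σ< g (suc n) ≈ g 0 + Σ< (λ i → g (suc i)) n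
  sumLt-head g zero    = trans (+-identityˡ _) (sym (+-identityʳ _))
  sumLt-head g (suc n) = trans (+-congʳ (sumLt-head g n)) (+-assoc _ _ _)

  sumLt-reverse : ∀ (g : ℕ → Carrier) n → Σ< g n ≈ Σ< (λ i → g (n ∸ suc i)) n
  sumLt-reverse g zero    = refl
  sumLt-reverse g (suc n) = begin
    Σ< g n + g n                      ≈⟨ +-comm _ _ ⟩
    g n + Σ< g n                      ≈⟨ +-congˡ (sumLt-reverse g n) ⟩
    g n + Σ< (λ i → g (n ∸ suc i)) n  ≈⟨ sumLt-head (λ i → g (suc n ∸ suc i)) n ⟨
    Σ< (λ i → g (n ∸ i)) (suc n)      ∎

  sumLt-δ : ∀ (g : ℕ → Carrier) n a → a < n → (∀ i → i < n → ¬ i ≡ a → g i ≈ 0#) → Σ< g n ≈ g a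
  sumLt-δ g (suc n) a a<1+n e with a ℕ.≟ n
  ... | yes P.refl = trans (+-congʳ (sumLt-zero n (λ i i<n → e i (ℕP.m<n⇒m<1+n i<n) (ℕP.<⇒≢ i<n))))
                           (+-identityˡ _)
  ... | no a≢n     = trans (+-cong (sumLt-δ g n a (ℕP.≤∧≢⇒< (ℕP.≤-pred a<1+n) a≢n) (λ i i<n → e i (ℕP.m<n⇒m<1+n i<n)))
                                   (e n ℕP.≤-refl (a≢n ∘ P.sym)))
                           (+-identityʳ _)

  sumLt-triangle : ∀ (G : ℕ → ℕ → Carrier) N →
    Σ< (λ i → Σ< (λ a → G a (i ∸ a)) (suc i)) (suc N) ≈ Σ< (λ a → Σ< (G a) (suc (N ∸ a))) (suc N)
  sumLt-triangle G zero    = refl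
  sumLt-triangle G (suc N) = begin
    Σ< (λ i → Σ< (λ a → G a (i ∸ a)) (suc i)) (suc N) + Σ< (λ a → G a (suc N ∸ a)) (suc (suc N))
      ≈⟨ +-congʳ (sumLt-triangle G N) ⟩
    Σ< (λ a → Σ< (G a) (suc (N ∸ a))) (suc N) + Σ< (λ a → G a (suc N ∸ a)) (suc (suc N))
      ≈⟨ +-assoc _ _ _ ⟨
    (Σ< (λ a → Σ< (G a) (suc (N ∸ a))) (suc N) + Σ< (λ a → G a (suc N ∸ a)) (suc N)) + G (suc N) (suc N ∸ suc N)
      ≈⟨ +-congʳ (sumLt-+ _ _ (suc N)) ⟨
    Σ< (λ a → Σ< (G a) (suc (N ∸ a)) + G a (suc N ∸ a)) (suc N) + G (suc N) (N ∸ N)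
      ≈⟨ +-cong (sumLt-cong (suc N) grow) (sym empty+) ⟩
    Σ< (λ a → Σ< (G a) (suc (suc N ∸ a))) (suc N) + Σ< (G (suc N)) (suc (suc N ∸ suc N)) ∎
    where
    empty+ : Σ< (G (suc N)) (N ∸ N) + G (suc N) (N ∸ N) ≈ G (suc N) (N ∸ N)
    empty+ = trans (+-congʳ (reflexive (P.cong (Σ< (G (suc N))) (ℕP.n∸n≡0 N)))) (+-identityˡ _)
    grow : ∀ a → a < suc N → Σ< (G a) (suc (N ∸ a)) + G a (suc N ∸ a) ≈ Σ< (G a) (suc (suc N ∸ a))
    grow a a<1+N = reflexive (P.cong (λ z → Σ< (G a) z + G a (suc N ∸ a)) (P.sym (ℕP.+-∸-assoc 1 (ℕP.≤-pred a<1+N))))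

  infix 4 _≋_
  _≋_ : Series F → Series F → Set ℓ
  s ≋ t = ∀ n → s n ≈ t n

  _⊕_ : Series F → Series F → Series F
  (s ⊕ t) n = s n + t n

  𝟘 : Series F
  𝟘 _ = 0#

  𝟙 : Series F
  𝟙 = oneS F

  _⊛_ : Series F → Series F → Series F
  _⊛_ = mulS F

  ⊛-cong : ∀ {f f′ g g′} → f ≋ f′ → g ≋ g′ → (f ⊛ g) ≋ (f′ ⊛ g′)
  ⊛-cong ef eg N = sumLt-cong (suc N) (λ i _ → *-cong (ef i) (eg (N ∸ i)))

  ⊛-comm : ∀ f g → (f ⊛ g) ≋ (g ⊛ f)
  ⊛-comm f g N = trans (sumLt-reverse _ (suc N)) (sumLt-cong (suc N) (λ i i<1+N →
    trans (*-comm _ _) (reflexive (P.cong (λ z → g z * f (N ∸ i)) (ℕP.m∸[m∸n]≡n (ℕP.≤-pred i<1+N))))))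

  ⊛-identityˡ : ∀ g → (𝟙 ⊛ g) ≋ g
  ⊛-identityˡ g N = begin
    Σ< (λ i → oneS F i * g (N ∸ i)) (suc N)                ≈⟨ sumLt-head _ N ⟩
    1# * g N + Σ< (λ i → 0# * g (N ∸ suc i)) N             ≈⟨ +-cong (*-identityˡ _) (sumLt-zero N (λ i _ → zeroˡ _)) ⟩
    g N + 0#                                               ≈⟨ +-identityʳ _ ⟩
    g N                                                    ∎

  ⊛-distribʳ : ∀ x y z → ((y ⊕ z) ⊛ x) ≋ ((y ⊛ x) ⊕ (z ⊛ x))
  ⊛-distribʳ x y z N = trans (sumLt-cong (suc N) (λ i _ → distribʳ _ _ _)) (sumLt-+ _ _ (suc N))

  ⊛-assoc : ∀ f g h → ((f ⊛ g) ⊛ h) ≋ (f ⊛ (g ⊛ h))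
  ⊛-assoc f g h N = begin
    Σ< (λ i → Σ< (λ a → f a * g (i ∸ a)) (suc i) * h (N ∸ i)) (suc N)
      ≈⟨ sumLt-cong (suc N) (λ i _ → sym (*-distribʳ-sumLt _ _ (suc i))) ⟩
    Σ< (λ i → Σ< (λ a → f a * g (i ∸ a) * h (N ∸ i)) (suc i)) (suc N)
      ≈⟨ sumLt-cong (suc N) (λ i _ → sumLt-cong (suc i) (λ a a<1+i → reflexive (P.cong (λ z → f a * g (i ∸ a) * h (N ∸ z)) (P.sym (ℕP.m+[n∸m]≡n (ℕP.≤-pred a<1+i)))))) ⟩
    Σ< (λ i → Σ< (λ a → G a (i ∸ a)) (suc i)) (suc N)
      ≈⟨ sumLt-triangle G N ⟩
    Σ< (λ a → Σ< (G a) (suc (N ∸ a))) (suc N)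
      ≈⟨ sumLt-cong (suc N) (λ a _ → trans (sumLt-cong (suc (N ∸ a)) (λ b _ → reassoc a b)) (*-distribˡ-sumLt _ _ (suc (N ∸ a)))) ⟩
    Σ< (λ a → f a * Σ< (λ b → g b * h (N ∸ a ∸ b)) (suc (N ∸ a))) (suc N) ∎
    where
    G : ℕ → ℕ → Carrier
    G a b = f a * g b * h (N ∸ (a ℕ.+ b))
    reassoc : ∀ a b → G a b ≈ f a * (g b * h (N ∸ a ∸ b))
    reassoc a b = trans (*-assoc _ _ _) (*-congˡ (*-congˡ (reflexive (P.cong h (P.sym (ℕP.∸-+-assoc N a b))))))

  ≋-isEquivalence : IsEquivalence _≋_
  ≋-isEquivalence = record { refl = λ _ → refl ; sym = λ e n → sym (e n) ; trans = λ e f n → trans (e n) (f n) }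

  ⊕-isCommutativeMonoid : IsCommutativeMonoid _≋_ _⊕_ 𝟘
  ⊕-isCommutativeMonoid = record
    { isMonoid = record
      { isSemigroup = record
        { isMagma = record { isEquivalence = ≋-isEquivalence ; ∙-cong = λ e f n → +-cong (e n) (f n) }
        ; assoc = λ _ _ _ _ → +-assoc _ _ _ }
      ; identity = (λ _ _ → +-identityˡ _) , (λ _ _ → +-identityʳ _) }
    ; comm = λ _ _ _ → +-comm _ _ }

  ⊛-isCommutativeMonoid : IsCommutativeMonoid _≋_ _⊛_ 𝟙
  ⊛-isCommutativeMonoid = record
    { isMonoid = record
      { isSemigroup = record
        { isMagma = record { isEquivalence = ≋-isEquivalence ; ∙-cong = ⊛-cong }
        ; assoc = ⊛-assoc }
      ; identity = ⊛-identityˡ , (λ x n → trans (⊛-comm x 𝟙 n) (⊛-identityˡ x n)) }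
    ; comm = ⊛-comm }

  seriesSemiring : CommutativeSemiring c ℓ
  seriesSemiring = record
    { isCommutativeSemiring = isCommutativeSemiringˡ record
      { +-isCommutativeMonoid = ⊕-isCommutativeMonoid
      ; *-isCommutativeMonoid = ⊛-isCommutativeMonoid
      ; distribʳ = ⊛-distribʳ
      ; zeroˡ = λ x N → sumLt-zero (suc N) (λ _ _ → zeroˡ _) } }

  module SR = CommutativeSemiring seriesSemiring
  open import Algebra.Properties.Semiring.Exp SR.semiring public
    using () renaming (_^_ to _^ˢ_; ^-congˡ to ^ˢ-congˡ; ^-assocʳ to ^ˢ-assocʳ; ^-homo-* to ^ˢ-homo-*)
  open import Algebra.Properties.CommutativeSemiring.Exp seriesSemiring public
    using () renaming (^-distrib-* to ^ˢ-distrib-*)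
  open import Algebra.Properties.Semiring.Mult SR.semiring public
    using () renaming (_×_ to _×ˢ_)

  powS≋^ˢ : ∀ g j → powS F g j ≋ (g ^ˢ j)
  powS≋^ˢ g zero    _ = refl
  powS≋^ˢ g (suc j)   = ⊛-cong (λ _ → refl) (powS≋^ˢ g j)

  ι-+ : ∀ a b → ι F (a ℕ.+ b) ≈ ι F a + ι F b
  ι-+ zero    b = sym (+-identityˡ _)
  ι-+ (suc a) b = trans (+-congˡ (ι-+ a b)) (sym (+-assoc _ _ _))

  ι-* : ∀ a b → ι F (a ℕ.* b) ≈ ι F a * ι F b
  ι-* zero    b = sym (zeroˡ _)
  ι-* (suc a) b = trans (ι-+ b (a ℕ.* b)) (trans (+-cong (sym (*-identityˡ _)) (ι-* a b)) (sym (distribʳ _ _ _)))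

  ×ˢ-coeff : ∀ n s d → (n ×ˢ s) d ≈ ι F n * s d
  ×ˢ-coeff zero    s d = sym (zeroˡ _)
  ×ˢ-coeff (suc n) s d = trans (+-cong (sym (*-identityˡ _)) (×ˢ-coeff n s d)) (sym (distribʳ _ _ _))

  ⊕-cancelʳ : ∀ {a b z} → (a ⊕ z) ≋ (b ⊕ z) → a ≋ b
  ⊕-cancelʳ {a} {b} {z} e n = +-cancelʳ (z n) (a n) (b n) (e n)

  monomial : ℕ → Series F
  monomial a n with a ℕ.≟ n
  ... | yes _ = 1#
  ... | no  _ = 0#

  monomial-≡ : ∀ a → monomial a a ≈ 1#
  monomial-≡ a with a ℕ.≟ a
  ... | yes _ = refl
  ... | no a≢a = ⊥-elim (a≢a P.refl)

  monomial-≢ : ∀ a n → ¬ a ≡ n → monomial a n ≈ 0#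
  monomial-≢ a n a≢n with a ℕ.≟ n
  ... | yes a≡n = ⊥-elim (a≢n a≡n)
  ... | no _    = refl

  monomial-cong-⇔ : ∀ {a b x y} → (a ≡ x → b ≡ y) → (b ≡ y → a ≡ x) → monomial a x ≈ monomial b y
  monomial-cong-⇔ {a} {b} {x} {y} to from = by-cases (a ℕ.≟ x)
    where
    by-cases : Dec (a ≡ x) → monomial a x ≈ monomial b y
    by-cases (yes P.refl) = trans (monomial-≡ a) (trans (sym (monomial-≡ b)) (reflexive (P.cong (monomial b) (to P.refl))))
    by-cases (no a≢x)     = trans (monomial-≢ a x a≢x) (sym (monomial-≢ b y (a≢x ∘ from)))

  𝟙≋monomial-0 : 𝟙 ≋ monomial 0
  𝟙≋monomial-0 zero    = sym (monomial-≡ 0)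
  𝟙≋monomial-0 (suc n) = sym (monomial-≢ 0 (suc n) (λ ()))

  sumLt-monomial : ∀ a n (h : ℕ → Carrier) → a < n → Σ< (λ l → monomial a l * h l) n ≈ h a
  sumLt-monomial a n h a<n = trans (sumLt-δ _ n a a<n off-diagonal) (trans (*-congʳ (monomial-≡ a)) (*-identityˡ _))
    where
    off-diagonal : ∀ i → i < n → ¬ i ≡ a → monomial a i * h i ≈ 0#
    off-diagonal i _ i≢a = trans (*-congʳ (monomial-≢ a i (i≢a ∘ P.sym))) (zeroˡ _)

  monomial-⊛-≥ : ∀ a s N → a ≤ N → (monomial a ⊛ s) N ≈ s (N ∸ a)
  monomial-⊛-≥ a s N a≤N = sumLt-monomial a (suc N) (λ i → s (N ∸ i)) (s≤s a≤N)

  monomial-⊛-< : ∀ a s N → N < a → (monomial a ⊛ s) N ≈ 0#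
  monomial-⊛-< a s N N<a = sumLt-zero (suc N) (λ i i<1+N →
    trans (*-congʳ (monomial-≢ a i (λ { P.refl → ℕP.<⇒≱ N<a (ℕP.≤-pred i<1+N) }))) (zeroˡ _))

  monomial-⊛-monomial : ∀ a b → (monomial a ⊛ monomial b) ≋ monomial (a ℕ.+ b)
  monomial-⊛-monomial a b N with a ℕ.≤? N
  ... | no a≰N = trans (monomial-⊛-< a (monomial b) N (ℕP.≰⇒> a≰N))
                       (sym (monomial-≢ (a ℕ.+ b) N (λ a+b≡N → a≰N (P.subst (a ≤_) a+b≡N (ℕP.m≤m+n a b)))))
  ... | yes a≤N = trans (monomial-⊛-≥ a (monomial b) N a≤N) (monomial-cong-⇔ to from)
    where
    to : b ≡ N ∸ a → a ℕ.+ b ≡ N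
    to P.refl = ℕP.m+[n∸m]≡n a≤N
    from : a ℕ.+ b ≡ N → b ≡ N ∸ a
    from P.refl = P.sym (ℕP.m+n∸m≡n a b)

  monomial-^ : ∀ a j → (monomial a ^ˢ j) ≋ monomial (a ℕ.* j)
  monomial-^ a zero    n = trans (𝟙≋monomial-0 n) (reflexive (P.cong (λ z → monomial z n) (P.sym (ℕP.*-zeroʳ a))))
  monomial-^ a (suc j) n = trans (⊛-cong (λ _ → refl) (monomial-^ a j) n)
    (trans (monomial-⊛-monomial a (a ℕ.* j) n) (reflexive (P.cong (λ z → monomial z n) (P.sym (ℕP.*-suc a j)))))

  X : Series F
  X = monomial 1

  X^ˢ : ∀ j → (X ^ˢ j) ≋ monomial j
  X^ˢ j n = trans (monomial-^ 1 j n) (reflexive (P.cong (λ z → monomial z n) (ℕP.*-identityˡ j)))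

  𝟙-^ˢ : ∀ j → (𝟙 ^ˢ j) ≋ 𝟙
  𝟙-^ˢ zero    n = refl
  𝟙-^ˢ (suc j) n = trans (⊛-cong (λ _ → refl) (𝟙-^ˢ j) n) (⊛-identityˡ 𝟙 n)

  SupportedOnMultiples : ℕ → Series F → Set ℓ
  SupportedOnMultiples Q f = ∀ l → ¬ Q ∣ l → f l ≈ 0#

  infix 4 _≈[<_]_
  _≈[<_]_ : Series F → ℕ → Series F → Set ℓ
  s ≈[< M ] t = ∀ d → d < M → s d ≈ t d

  ⊛-cong-≈[<] : ∀ {M s s′ t t′} → s ≈[< M ] s′ → t ≈[< M ] t′ → (s ⊛ t) ≈[< M ] (s′ ⊛ t′)
  ⊛-cong-≈[<] es et d d<M = sumLt-cong (suc d) (λ i i<1+d →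
    *-cong (es i (ℕP.≤-<-trans (ℕP.≤-pred i<1+d) d<M)) (et (d ∸ i) (ℕP.≤-<-trans (ℕP.m∸n≤m d i) d<M)))

  ^ˢ-cong-≈[<] : ∀ {M s t} → s ≈[< M ] t → ∀ j → (s ^ˢ j) ≈[< M ] (t ^ˢ j)
  ^ˢ-cong-≈[<] e zero    d _ = refl
  ^ˢ-cong-≈[<] e (suc j)     = ⊛-cong-≈[<] e (^ˢ-cong-≈[<] e j)

  VanishesBelow : ℕ → Series F → Set ℓ
  VanishesBelow M s = s ≈[< M ] 𝟘

  ⊛-vanishesBelow : ∀ a b {s t} → VanishesBelow a s → VanishesBelow b t → VanishesBelow (a ℕ.+ b) (s ⊛ t)
  ⊛-vanishesBelow a b {s} {t} vs vt d d<a+b = sumLt-zero (suc d) (λ i i<1+d → term i (ℕP.≤-pred i<1+d))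
    where
    term : ∀ i → i ≤ d → s i * t (d ∸ i) ≈ 0#
    term i i≤d with i ℕ.<? a
    ... | yes i<a = trans (*-congʳ (vs i i<a)) (zeroˡ _)
    ... | no  i≮a = trans (*-congˡ (vt (d ∸ i) (ℕP.+-cancelˡ-< a _ _ (ℕP.≤-<-trans a+[d∸i]≤d d<a+b)))) (zeroʳ _)
      where
      a+[d∸i]≤d : a ℕ.+ (d ∸ i) ≤ d
      a+[d∸i]≤d = ℕP.≤-trans (ℕP.+-monoˡ-≤ (d ∸ i) (ℕP.≮⇒≥ i≮a)) (ℕP.≤-reflexive (ℕP.m+[n∸m]≡n i≤d))

  ^ˢ-vanishesBelow : ∀ a {s} → VanishesBelow a s → ∀ j → VanishesBelow (j ℕ.* a) (s ^ˢ j)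
  ^ˢ-vanishesBelow a vs zero    d ()
  ^ˢ-vanishesBelow a vs (suc j)      = ⊛-vanishesBelow a (j ℕ.* a) vs (^ˢ-vanishesBelow a vs j)

  [𝟙⊕w]^ˢl≈[<2M]𝟙⊕l×w : ∀ {M w} → VanishesBelow M w → ∀ l → ((𝟙 ⊕ w) ^ˢ l) ≈[< M ℕ.+ M ] (𝟙 ⊕ (l ×ˢ w))
  [𝟙⊕w]^ˢl≈[<2M]𝟙⊕l×w vw zero    n _ = sym (+-identityʳ _)
  [𝟙⊕w]^ˢl≈[<2M]𝟙⊕l×w {M} {w} vw (suc l) n n<2M = begin
    ((𝟙 ⊕ w) ⊛ ((𝟙 ⊕ w) ^ˢ l)) n   ≈⟨ ⊛-cong-≈[<] {M ℕ.+ M} {𝟙 ⊕ w} (λ _ _ → refl) ([𝟙⊕w]^ˢl≈[<2M]𝟙⊕l×w vw l) n n<2M ⟩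
    ((𝟙 ⊕ w) ⊛ Y) n                ≈⟨ ⊛-distribʳ Y 𝟙 w n ⟩
    (𝟙 ⊛ Y) n + (w ⊛ Y) n          ≈⟨ +-cong (⊛-identityˡ Y n) (SR.distribˡ w 𝟙 (l ×ˢ w) n) ⟩
    Y n + ((w ⊛ 𝟙) n + (w ⊛ (l ×ˢ w)) n)
      ≈⟨ +-congˡ (+-cong (trans (⊛-comm w 𝟙 n) (⊛-identityˡ w n)) (⊛-vanishesBelow M M vw lw-vanishes n n<2M)) ⟩
    (oneS F n + (l ×ˢ w) n) + (w n + 0#) ≈⟨ +-congˡ (+-identityʳ _) ⟩
    (oneS F n + (l ×ˢ w) n) + w n   ≈⟨ trans (+-assoc _ _ _) (+-congˡ (+-comm _ _)) ⟩
    oneS F n + (w n + (l ×ˢ w) n)   ∎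
    where
    Y : Series F
    Y = 𝟙 ⊕ (l ×ˢ w)
    lw-vanishes : VanishesBelow M (l ×ˢ w)
    lw-vanishes d d<M = trans (×ˢ-coeff l w d) (trans (*-congˡ (vw d d<M)) (zeroʳ _))

  binomialSeries-coeff : ∀ A d → ((𝟙 ⊕ X) ^ˢ A) d ≈ ι F (A C d)
  binomialSeries-coeff zero    zero    = sym (+-identityʳ _)
  binomialSeries-coeff zero    (suc d) = refl
  binomialSeries-coeff (suc A) d       = trans (⊛-distribʳ B^A 𝟙 X d) (pascal d)
    where
    B^A : Series F
    B^A = (𝟙 ⊕ X) ^ˢ A
    pascal : ∀ d → (𝟙 ⊛ B^A) d + (X ⊛ B^A) d ≈ ι F (suc A C d)
    pascal zero    = trans (+-cong (⊛-identityˡ B^A 0) (monomial-⊛-< 1 B^A 0 (s≤s z≤n)))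
                           (trans (+-identityʳ _) (binomialSeries-coeff A 0))
    pascal (suc d) = begin
      (𝟙 ⊛ B^A) (suc d) + (X ⊛ B^A) (suc d)
        ≈⟨ +-cong (⊛-identityˡ B^A (suc d)) (monomial-⊛-≥ 1 B^A (suc d) (s≤s z≤n)) ⟩
      B^A (suc d) + B^A d
        ≈⟨ +-cong (binomialSeries-coeff A (suc d)) (binomialSeries-coeff A d) ⟩
      ι F (A C suc d) + ι F (A C d)   ≈⟨ +-comm _ _ ⟩
      ι F (A C d) + ι F (A C suc d)   ≈⟨ ι-+ (A C d) (A C suc d) ⟨
      ι F (A C d ℕ.+ A C suc d)       ≡⟨ P.cong (ι F) (nCk+nC[k+1]≡[n+1]C[k+1] A d) ⟩
      ι F (suc A C suc d)             ∎

  compS-cong : ∀ f {g h} → g ≋ h → compS F f g ≋ compS F f h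
  compS-cong f {g} {h} g≋h N = sumLt-cong (suc N) (λ j _ → *-congˡ
    (trans (powS≋^ˢ g j N) (trans (^ˢ-congˡ j g≋h N) (sym (powS≋^ˢ h j N)))))

  compS-X : ∀ f → compS F f X ≋ f
  compS-X f N = trans (sumLt-δ _ (suc N) N ℕP.≤-refl off-diagonal) (trans (*-congˡ (trans (X^N≈ N N) (monomial-≡ N))) (*-identityʳ _))
    where
    X^N≈ : ∀ i N → powS F X i N ≈ monomial i N
    X^N≈ i N = trans (powS≋^ˢ X i N) (X^ˢ i N)
    off-diagonal : ∀ i → i < suc N → ¬ i ≡ N → f i * powS F X i N ≈ 0#
    off-diagonal i _ i≢N = trans (*-congˡ (trans (X^N≈ i N) (monomial-≢ i N i≢N))) (zeroʳ _)

module Frobenius {a ℓ} (R : CommutativeSemiring a ℓ) where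
  open CommutativeSemiring R
  open import Algebra.Properties.Semiring.Mult semiring using (_×_)
  open import Algebra.Properties.Monoid.Mult +-monoid using (×-congʳ; ×-assocˡ; ×-homo-1)
  open import Algebra.Properties.Semiring.Exp semiring using (_^_; ^-congˡ; ^-assocʳ)
  open import Algebra.Properties.Monoid.Sum +-monoid
    using (sum; sum-init-last; sum-cong-≋; sum-replicate; sum-replicate-zero)
  open import Algebra.Properties.CommutativeSemiring.Binomial R using (theorem; binomialTerm)
  open import Data.Fin using (Fin; toℕ; inject₁; fromℕ) renaming (zero to fzero; suc to fsuc)
  import Data.Fin.Properties as FinP
  open import Relation.Binary.Reasoning.Setoid setoid

  ×-zeroʳ : ∀ n → n × 0# ≈ 0#
  ×-zeroʳ n = trans (sym (sum-replicate n)) (sum-replicate-zero n)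

  binomial-without-middle : ∀ q → (∀ k z → 0 < k → k < suc q → (suc q C k) × z ≈ 0#) →
                            ∀ x y → (x + y) ^ suc q ≈ x ^ suc q + y ^ suc q
  binomial-without-middle q middle x y = begin
    (x + y) ^ n                                       ≈⟨ theorem n x y ⟩
    t fzero + sum (t ∘ fsuc)                          ≈⟨ +-congˡ (sum-init-last (t ∘ fsuc)) ⟩
    t fzero + (sum (t ∘ fsuc ∘ inject₁) + t (fsuc (fromℕ q)))
      ≈⟨ +-cong first (+-cong (trans (sum-cong-≋ {q} inner) (sum-replicate-zero q)) last) ⟩
    y ^ n + (0# + x ^ n)                              ≈⟨ trans (+-congˡ (+-identityˡ _)) (+-comm _ _) ⟩
    x ^ n + y ^ n                                     ∎
    where
    n : ℕ
    n = suc q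
    t : Fin (suc n) → Carrier
    t = binomialTerm x y n
    first : t fzero ≈ y ^ n
    first = trans (+-identityʳ _) (*-identityˡ _)
    inner : ∀ (i : Fin q) → t (fsuc (inject₁ i)) ≈ 0#
    inner i = middle _ _ (s≤s z≤n) (s≤s (P.subst (_< q) (P.sym (FinP.toℕ-inject₁ i)) (FinP.toℕ<n i)))
    last : t (fsuc (fromℕ q)) ≈ x ^ n
    last = begin
      (n C suc (toℕ (fromℕ q))) × (x ^ suc (toℕ (fromℕ q)) * y ^ (n ∸ suc (toℕ (fromℕ q))))
        ≡⟨ P.cong (λ k → (n C k) × (x ^ k * y ^ (n ∸ k))) (P.cong suc (FinP.toℕ-fromℕ q)) ⟩
      (n C n) × (x ^ n * y ^ (n ∸ n))
        ≡⟨ P.cong₂ (λ u v → u × (x ^ n * y ^ v)) (nCn≡1 n) (ℕP.n∸n≡0 n) ⟩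
      1 × (x ^ n * 1#)   ≈⟨ trans (×-homo-1 _) (*-identityʳ _) ⟩
      x ^ n              ∎

  ×-multiple : ∀ {p} → (∀ x → p × x ≈ 0#) → ∀ {m} z → p ∣ m → m × z ≈ 0#
  ×-multiple {p} char z (divides q P.refl) = begin
    (q ℕ.* p) × z ≈⟨ ×-assocˡ z q p ⟨
    q × (p × z)   ≈⟨ ×-congʳ q (char z) ⟩
    q × 0#        ≈⟨ ×-zeroʳ q ⟩
    0#            ∎

  frobenius : ∀ {p} → Prime p → (∀ x → p × x ≈ 0#) → ∀ x y → (x + y) ^ p ≈ x ^ p + y ^ p
  frobenius {zero}  pr = ⊥-elim (NonZero.nonZero (prime⇒nonZero pr))
  frobenius {suc q} pr char = binomial-without-middle q λ k z 0<k k<p → ×-multiple char z (p∣pCk pr 0<k k<p)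

  module _ {p} (pr : Prime p) (char : ∀ x → p × x ≈ 0#) where

    frobenius-^ : ∀ e x y → (x + y) ^ (p ℕ.^ e) ≈ x ^ (p ℕ.^ e) + y ^ (p ℕ.^ e)
    frobenius-^ zero    x y = distribʳ 1# x y
    frobenius-^ (suc e) x y = begin
      (x + y) ^ (p ℕ.* q)           ≈⟨ ^-by-p*q (x + y) ⟩
      ((x + y) ^ q) ^ p             ≈⟨ ^-congˡ p (frobenius-^ e x y) ⟩
      (x ^ q + y ^ q) ^ p           ≈⟨ frobenius pr char _ _ ⟩
      (x ^ q) ^ p + (y ^ q) ^ p     ≈⟨ +-cong (^-by-p*q x) (^-by-p*q y) ⟨
      x ^ (p ℕ.* q) + y ^ (p ℕ.* q) ∎
      where
      q : ℕ
      q = p ℕ.^ e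
      ^-by-p*q : ∀ z → z ^ (p ℕ.* q) ≈ (z ^ q) ^ p
      ^-by-p*q z = trans (reflexive (P.cong (z ^_) (ℕP.*-comm p q))) (sym (^-assocʳ z q p))

module PrimePowers (p : ℕ) (pr : Prime p) where
  instance
    p-nonZero : NonZero p
    p-nonZero = prime⇒nonZero pr

  1<p : 1 < p
  1<p = nonTrivial⇒n>1 p {{prime⇒nonTrivial pr}}

  infixl 7 _%p^_
  _%p^_ : ℕ → ℕ → ℕ
  A %p^ e = _%_ A (p ℕ.^ e) {{ℕP.m^n≢0 p e}}

module CharacteristicP {c ℓ} (F : Field c ℓ) (p : ℕ) (pr : Prime p) (char : HasChar F p) where
  open Field F
  open PowerSeries F
  open import Relation.Binary.Reasoning.Setoid setoid
  open import Algebra.Properties.Ring ring using (-‿distribˡ-*; -‿involutive; +-inverseʳ-unique)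
  open PrimePowers p pr

  ι-multiple : ∀ {j} → p ∣ j → ι F j ≈ 0#
  ι-multiple (divides q P.refl) = trans (ι-* q p) (trans (*-congˡ char) (zeroʳ _))

  frobeniusˢ : ∀ e s t → ((s ⊕ t) ^ˢ (p ℕ.^ e)) ≋ ((s ^ˢ (p ℕ.^ e)) ⊕ (t ^ˢ (p ℕ.^ e)))
  frobeniusˢ = Frobenius.frobenius-^ seriesSemiring pr p×ˢs≋𝟘
    where
    p×ˢs≋𝟘 : ∀ s → (p ×ˢ s) ≋ 𝟘
    p×ˢs≋𝟘 s d = trans (×ˢ-coeff p s d) (trans (*-congʳ char) (zeroˡ _))

  ^ˢp^e-cong-≈[<] : ∀ e {M s t} → s ≈[< M ] t → (s ^ˢ (p ℕ.^ e)) ≈[< p ℕ.^ e ℕ.* M ] (t ^ˢ (p ℕ.^ e))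
  ^ˢp^e-cong-≈[<] e {M} {s} {t} s≈t n n<QM = begin
    (s ^ˢ Q) n                 ≈⟨ ^ˢ-congˡ Q s≋t⊕d n ⟩
    ((t ⊕ d) ^ˢ Q) n           ≈⟨ frobeniusˢ e t d n ⟩
    (t ^ˢ Q) n + (d ^ˢ Q) n    ≈⟨ +-congˡ (^ˢ-vanishesBelow M d-vanishes Q n n<QM) ⟩
    (t ^ˢ Q) n + 0#            ≈⟨ +-identityʳ _ ⟩
    (t ^ˢ Q) n                 ∎
    where
    Q : ℕ
    Q = p ℕ.^ e
    d : Series F
    d m = s m - t m
    s≋t⊕d : s ≋ (t ⊕ d)
    s≋t⊕d m = sym (trans (+-comm _ _) (trans (+-assoc _ _ _) (trans (+-congˡ (-‿inverseˡ _)) (+-identityʳ _))))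
    d-vanishes : VanishesBelow M d
    d-vanishes m m<M = trans (+-congʳ (s≈t m m<M)) (-‿inverseʳ _)

  [𝟙⊕X]^ˢp^e≋𝟙⊕X^p^e : ∀ e → ((𝟙 ⊕ X) ^ˢ (p ℕ.^ e)) ≋ (𝟙 ⊕ monomial (p ℕ.^ e))
  [𝟙⊕X]^ˢp^e≋𝟙⊕X^p^e e n = trans (frobeniusˢ e 𝟙 X n) (+-cong (𝟙-^ˢ (p ℕ.^ e) n) (X^ˢ (p ℕ.^ e) n))

  -- (1+X)^(p^e) = 1 + X^(p^e), so (1+X)^A and (1+X)^(A mod p^e) differ by a factor
  -- that is 1 below degree p^e.
  binomialSeries-% : ∀ e A → ((𝟙 ⊕ X) ^ˢ A) ≈[< p ℕ.^ e ] ((𝟙 ⊕ X) ^ˢ (A %p^ e))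
  binomialSeries-% e A d d<M = begin
    (B ^ˢ A) d                                        ≡⟨ P.cong (λ n → (B ^ˢ n) d) (m≡m%n+[m/n]*n A M) ⟩
    (B ^ˢ (A % M ℕ.+ A / M ℕ.* M)) d                  ≈⟨ ^ˢ-homo-* B (A % M) (A / M ℕ.* M) d ⟩
    ((B ^ˢ (A % M)) ⊛ (B ^ˢ (A / M ℕ.* M))) d         ≈⟨ ⊛-cong-≈[<] {M} {B ^ˢ (A % M)} (λ _ _ → refl) B^qM≈𝟙 d d<M ⟩
    ((B ^ˢ (A % M)) ⊛ 𝟙) d                            ≈⟨ SR.*-identityʳ (B ^ˢ (A % M)) d ⟩
    (B ^ˢ (A % M)) d                                  ∎
    where
    B : Series F
    B = 𝟙 ⊕ X
    M : ℕ
    M = p ℕ.^ e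
    instance
      M-nonZero : NonZero M
      M-nonZero = ℕP.m^n≢0 p e
    B^M≈𝟙 : (B ^ˢ M) ≈[< M ] 𝟙
    B^M≈𝟙 n n<M = trans ([𝟙⊕X]^ˢp^e≋𝟙⊕X^p^e e n)
                        (trans (+-congˡ (monomial-≢ M n (λ M≡n → ℕP.<-irrefl (P.sym M≡n) n<M))) (+-identityʳ _))
    B^qM≈𝟙 : (B ^ˢ (A / M ℕ.* M)) ≈[< M ] 𝟙
    B^qM≈𝟙 n n<M = begin
      (B ^ˢ (A / M ℕ.* M)) n      ≡⟨ P.cong (λ z → (B ^ˢ z) n) (ℕP.*-comm (A / M) M) ⟩
      (B ^ˢ (M ℕ.* (A / M))) n    ≈⟨ ^ˢ-assocʳ B M (A / M) n ⟨
      ((B ^ˢ M) ^ˢ (A / M)) n     ≈⟨ ^ˢ-cong-≈[<] B^M≈𝟙 (A / M) n n<M ⟩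
      (𝟙 ^ˢ (A / M)) n            ≈⟨ 𝟙-^ˢ (A / M) n ⟩
      oneS F n                    ∎

  ι-C-% : ∀ e A {l} → l < p ℕ.^ e → ι F (A C l) ≈ ι F ((A %p^ e) C l)
  ι-C-% e A {l} l<M = trans (sym (binomialSeries-coeff A l))
                           (trans (binomialSeries-% e A l l<M) (binomialSeries-coeff (A %p^ e) l))

  φ : (ℕ → ℕ) → Series F
  φ = onePlusTPowMinusOne F

  φ-cong-≈[<] : ∀ E {t₁ t₂} → (∀ r → t₁ r %p^ (r ℕ.⊓ E) ≡ t₂ r %p^ (r ℕ.⊓ E)) → φ t₁ ≈[< p ℕ.^ E ] φ t₂
  φ-cong-≈[<] E h zero    _          = refl
  φ-cong-≈[<] E {t₁} {t₂} h (suc j) 1+j<p^E = begin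
    ι F (t₁ r C suc j)            ≈⟨ ι-C-% e (t₁ r) 1+j<p^e ⟩
    ι F ((t₁ r %p^ e) C suc j)    ≡⟨ P.cong (λ A → ι F (A C suc j)) (h r) ⟩
    ι F ((t₂ r %p^ e) C suc j)    ≈⟨ ι-C-% e (t₂ r) 1+j<p^e ⟨
    ι F (t₂ r C suc j)            ∎
    where
    r : ℕ
    r = suc (suc j)
    e : ℕ
    e = r ℕ.⊓ E
    1+j<p^e : suc j < p ℕ.^ e
    1+j<p^e with ℕP.≤-total r E
    ... | inj₁ r≤E = P.subst (λ z → suc j < p ℕ.^ z) (P.sym (ℕP.m≤n⇒m⊓n≡m r≤E)) (ℕP.<-trans (ℕP.n<1+n (suc j)) (n<m^n 1<p r))
    ... | inj₂ E≤r = P.subst (λ z → suc j < p ℕ.^ z) (P.sym (ℕP.m≥n⇒m⊓n≡n E≤r)) 1+j<p^E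

  φ⊕𝟙≋[𝟙⊕X]^ˢ : ∀ {t} A → (∀ r → t r %p^ r ≡ A %p^ r) → (φ t ⊕ 𝟙) ≋ ((𝟙 ⊕ X) ^ˢ A)
  φ⊕𝟙≋[𝟙⊕X]^ˢ A h zero    = trans (+-identityˡ _) (trans (sym (+-identityʳ _)) (sym (binomialSeries-coeff A 0)))
  φ⊕𝟙≋[𝟙⊕X]^ˢ {t} A h (suc j) = begin
    φ t (suc j) + 0#              ≈⟨ +-identityʳ _ ⟩
    ι F (t r C suc j)             ≈⟨ ι-C-% r (t r) 1+j<p^r ⟩
    ι F ((t r %p^ r) C suc j)     ≡⟨ P.cong (λ B → ι F (B C suc j)) (h r) ⟩
    ι F ((A %p^ r) C suc j)       ≈⟨ ι-C-% r A 1+j<p^r ⟨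
    ι F (A C suc j)               ≈⟨ binomialSeries-coeff A (suc j) ⟨
    ((𝟙 ⊕ X) ^ˢ A) (suc j)        ∎
    where
    r : ℕ
    r = suc (suc j)
    1+j<p^r : suc j < p ℕ.^ r
    1+j<p^r = ℕP.<-trans (ℕP.n<1+n (suc j)) (n<m^n 1<p r)

  φ-identity : ∀ {t} → (∀ r → t r %p^ r ≡ 1 %p^ r) → φ t ≋ X
  φ-identity h = ⊕-cancelʳ λ n →
    trans (φ⊕𝟙≋[𝟙⊕X]^ˢ 1 h n) (trans (SR.*-identityʳ (𝟙 ⊕ X) n) (+-comm _ _))

  actS-cong-≈[<] : ∀ e {f M t₁ t₂} → SupportedOnMultiples (p ℕ.^ e) f → φ t₁ ≈[< M ] φ t₂ →
                   actS F t₁ f ≈[< p ℕ.^ e ℕ.* M ] actS F t₂ f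
  actS-cong-≈[<] e {f} {M} {t₁} {t₂} f-supp φ≈φ D D<QM = sumLt-cong (suc D) term
    where
    Q : ℕ
    Q = p ℕ.^ e
    powS-by-Q : ∀ t l → powS F (φ t) (l ℕ.* Q) ≋ ((φ t ^ˢ Q) ^ˢ l)
    powS-by-Q t l n = trans (powS≋^ˢ (φ t) (l ℕ.* Q) n)
      (trans (reflexive (P.cong (λ z → (φ t ^ˢ z) n) (ℕP.*-comm l Q))) (sym (^ˢ-assocʳ (φ t) Q l n)))
    term : ∀ l → l < suc D → f l * powS F (φ t₁) l D ≈ f l * powS F (φ t₂) l D
    term l _ with Q ∣? l
    ... | no Q∤l = trans (*-congʳ (f-supp l Q∤l)) (trans (zeroˡ _) (sym (trans (*-congʳ (f-supp l Q∤l)) (zeroˡ _))))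
    ... | yes (divides l′ P.refl) = *-congˡ (begin
      powS F (φ t₁) (l′ ℕ.* Q) D    ≈⟨ powS-by-Q t₁ l′ D ⟩
      ((φ t₁ ^ˢ Q) ^ˢ l′) D         ≈⟨ ^ˢ-cong-≈[<] (^ˢp^e-cong-≈[<] e φ≈φ) l′ D D<QM ⟩
      ((φ t₂ ^ˢ Q) ^ˢ l′) D         ≈⟨ powS-by-Q t₂ l′ D ⟨
      powS F (φ t₂) (l′ ℕ.* Q) D    ∎)

  -- For t ≡ 1 + N with N = p^E, the substitution is ψ = (1+X)(1+X^N) − 1 = X (1 + v).
  module Unipotent (E : ℕ) (t : ℕ → ℕ) (t≡1+p^E : ∀ r → t r %p^ r ≡ suc (p ℕ.^ E) %p^ r) where
    open import Algebra.Properties.CommutativeSemigroup SR.+-commutativeSemigroup using (x∙yz≈y∙xz)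

    N : ℕ
    N = p ℕ.^ E
    ψ : Series F
    ψ = φ t
    v : Series F
    v = monomial (N ∸ 1) ⊕ monomial N

    1≤N : 1 ≤ N
    1≤N = ℕP.m^n>0 p E

    ψ≋X⊛[𝟙⊕v] : ψ ≋ (X ⊛ (𝟙 ⊕ v))
    ψ≋X⊛[𝟙⊕v] = ⊕-cancelʳ ψ⊕𝟙≈
      where
      W : Series F
      W = 𝟙 ⊕ monomial N
      X⊛[𝟙⊕v] : ∀ n → (X ⊛ (𝟙 ⊕ v)) n ≈ X n + (monomial N n + (X ⊛ monomial N) n)
      X⊛[𝟙⊕v] n = trans (SR.distribˡ X 𝟙 v n) (+-cong (SR.*-identityʳ X n) (trans (SR.distribˡ X (monomial (N ∸ 1)) (monomial N) n)
        (+-congʳ (trans (monomial-⊛-monomial 1 (N ∸ 1) n) (reflexive (P.cong (λ z → monomial z n) (ℕP.m+[n∸m]≡n 1≤N)))))))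
      rearrange : ∀ n → (X n + (monomial N n + (X ⊛ monomial N) n)) + oneS F n ≈
                        (oneS F n + monomial N n) + (X n + (X ⊛ monomial N) n)
      rearrange n = trans (+-comm _ _) (trans (+-congˡ (x∙yz≈y∙xz X (monomial N) (X ⊛ monomial N) n)) (sym (+-assoc _ _ _)))
      ψ⊕𝟙≈ : ∀ n → ψ n + oneS F n ≈ (X ⊛ (𝟙 ⊕ v)) n + oneS F n
      ψ⊕𝟙≈ n = begin
        ψ n + oneS F n                                         ≈⟨ φ⊕𝟙≋[𝟙⊕X]^ˢ (suc N) t≡1+p^E n ⟩
        ((𝟙 ⊕ X) ⊛ ((𝟙 ⊕ X) ^ˢ N)) n                           ≈⟨ ⊛-cong (λ _ → refl) ([𝟙⊕X]^ˢp^e≋𝟙⊕X^p^e E) n ⟩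
        ((𝟙 ⊕ X) ⊛ W) n                                        ≈⟨ ⊛-distribʳ W 𝟙 X n ⟩
        (𝟙 ⊛ W) n + (X ⊛ W) n                                  ≈⟨ +-cong (⊛-identityˡ W n) (SR.distribˡ X 𝟙 (monomial N) n) ⟩
        W n + ((X ⊛ 𝟙) n + (X ⊛ monomial N) n)                 ≈⟨ +-congˡ (+-congʳ (SR.*-identityʳ X n)) ⟩
        (oneS F n + monomial N n) + (X n + (X ⊛ monomial N) n) ≈⟨ rearrange n ⟨
        (X n + (monomial N n + (X ⊛ monomial N) n)) + oneS F n ≈⟨ +-congʳ (X⊛[𝟙⊕v] n) ⟨
        (X ⊛ (𝟙 ⊕ v)) n + oneS F n                             ∎

    module _ (e : ℕ) where
      Q : ℕ
      Q = p ℕ.^ e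
      w : Series F
      w = v ^ˢ Q

      ψ^ˢQ : (ψ ^ˢ Q) ≋ (monomial Q ⊛ (𝟙 ⊕ w))
      ψ^ˢQ n = begin
        (ψ ^ˢ Q) n                              ≈⟨ ^ˢ-congˡ Q ψ≋X⊛[𝟙⊕v] n ⟩
        ((X ⊛ (𝟙 ⊕ v)) ^ˢ Q) n                  ≈⟨ ^ˢ-distrib-* X (𝟙 ⊕ v) Q n ⟩
        ((X ^ˢ Q) ⊛ ((𝟙 ⊕ v) ^ˢ Q)) n           ≈⟨ ⊛-cong (X^ˢ Q) (λ m → trans (frobeniusˢ e 𝟙 v m) (+-congʳ (𝟙-^ˢ Q m))) n ⟩
        (monomial Q ⊛ (𝟙 ⊕ w)) n                ∎

      w≋ : w ≋ (monomial ((N ∸ 1) ℕ.* Q) ⊕ monomial (N ℕ.* Q))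
      w≋ n = trans (frobeniusˢ e (monomial (N ∸ 1)) (monomial N) n) (+-cong (monomial-^ (N ∸ 1) Q n) (monomial-^ N Q n))

      w-vanishes : VanishesBelow (Q ℕ.* (N ∸ 1)) w
      w-vanishes = ^ˢ-vanishesBelow (N ∸ 1) v-vanishes Q
        where
        v-vanishes : VanishesBelow (N ∸ 1) v
        v-vanishes d d<N-1 = trans (+-cong (monomial-≢ _ d (λ eq → ℕP.<-irrefl (P.sym eq) d<N-1))
                                           (monomial-≢ N d (λ eq → ℕP.<⇒≱ d<N-1 (ℕP.≤-trans (ℕP.m∸n≤m N 1) (ℕP.≤-reflexive eq)))))
                                   (+-identityʳ _)

      powS-ψ-coeff : ∀ l′ D → Q ℕ.* l′ ≤ D → D ∸ Q ℕ.* l′ < Q ℕ.* (N ∸ 1) ℕ.+ Q ℕ.* (N ∸ 1) →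
        powS F ψ (l′ ℕ.* Q) D ≈ oneS F (D ∸ Q ℕ.* l′) + ι F l′ * w (D ∸ Q ℕ.* l′)
      powS-ψ-coeff l′ D Ql′≤D r<2M = begin
        powS F ψ (l′ ℕ.* Q) D                         ≈⟨ powS≋^ˢ ψ (l′ ℕ.* Q) D ⟩
        (ψ ^ˢ (l′ ℕ.* Q)) D                           ≡⟨ P.cong (λ z → (ψ ^ˢ z) D) (ℕP.*-comm l′ Q) ⟩
        (ψ ^ˢ (Q ℕ.* l′)) D                           ≈⟨ ^ˢ-assocʳ ψ Q l′ D ⟨
        ((ψ ^ˢ Q) ^ˢ l′) D                            ≈⟨ ^ˢ-congˡ l′ ψ^ˢQ D ⟩
        ((monomial Q ⊛ (𝟙 ⊕ w)) ^ˢ l′) D              ≈⟨ ^ˢ-distrib-* (monomial Q) (𝟙 ⊕ w) l′ D ⟩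
        ((monomial Q ^ˢ l′) ⊛ ((𝟙 ⊕ w) ^ˢ l′)) D      ≈⟨ ⊛-cong {g = (𝟙 ⊕ w) ^ˢ l′} (monomial-^ Q l′) (λ _ → refl) D ⟩
        (monomial (Q ℕ.* l′) ⊛ ((𝟙 ⊕ w) ^ˢ l′)) D     ≈⟨ monomial-⊛-≥ (Q ℕ.* l′) ((𝟙 ⊕ w) ^ˢ l′) D Ql′≤D ⟩
        ((𝟙 ⊕ w) ^ˢ l′) r                             ≈⟨ [𝟙⊕w]^ˢl≈[<2M]𝟙⊕l×w w-vanishes l′ r r<2M ⟩
        oneS F r + (l′ ×ˢ w) r                        ≈⟨ +-congˡ (×ˢ-coeff l′ w r) ⟩
        oneS F r + ι F l′ * w r                       ∎
        where
        r : ℕ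
        r = D ∸ Q ℕ.* l′

      instance
        Q-nonZero : NonZero Q
        Q-nonZero = ℕP.m^n≢0 p e

      monomial-index-shift : ∀ l′ s a b → l′ ℕ.+ s ≡ a ℕ.+ b →
                             monomial (a ℕ.* Q) (Q ℕ.* s) ≈ monomial (Q ℕ.* b) (l′ ℕ.* Q)
      monomial-index-shift l′ s a b l′+s≡a+b = monomial-cong-⇔ to from
        where
        to : a ℕ.* Q ≡ Q ℕ.* s → Q ℕ.* b ≡ l′ ℕ.* Q
        to aQ≡Qs = P.trans (ℕP.*-comm Q b) (P.cong (ℕ._* Q) (P.sym l′≡b))
          where
          a≡s : a ≡ s
          a≡s = ℕP.*-cancelʳ-≡ a s Q (P.trans aQ≡Qs (ℕP.*-comm Q s))
          l′≡b : l′ ≡ b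
          l′≡b = ℕP.+-cancelʳ-≡ s l′ b (P.trans l′+s≡a+b (P.trans (P.cong (ℕ._+ b) a≡s) (ℕP.+-comm s b)))
        from : Q ℕ.* b ≡ l′ ℕ.* Q → a ℕ.* Q ≡ Q ℕ.* s
        from Qb≡l′Q = P.trans (P.cong (ℕ._* Q) (P.sym s≡a)) (ℕP.*-comm s Q)
          where
          b≡l′ : b ≡ l′
          b≡l′ = ℕP.*-cancelʳ-≡ b l′ Q (P.trans (ℕP.*-comm b Q) Qb≡l′Q)
          s≡a : s ≡ a
          s≡a = ℕP.+-cancelˡ-≡ l′ s a (P.trans l′+s≡a+b (P.trans (P.cong (a ℕ.+_) b≡l′) (ℕP.+-comm a l′)))

      ι-*-monomial : ∀ l′ b → ι F l′ * monomial (Q ℕ.* b) (l′ ℕ.* Q) ≈ monomial (Q ℕ.* b) (l′ ℕ.* Q) * ι F b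
      ι-*-monomial l′ b with b ℕ.≟ l′
      ... | yes P.refl = *-comm _ _
      ... | no b≢l′    = trans (*-congˡ vanishes) (trans (zeroʳ _) (sym (trans (*-congʳ vanishes) (zeroˡ _))))
        where
        vanishes : monomial (Q ℕ.* b) (l′ ℕ.* Q) ≈ 0#
        vanishes = monomial-≢ _ _ (λ Qb≡l′Q → b≢l′ (ℕP.*-cancelʳ-≡ b l′ Q (P.trans (ℕP.*-comm b Q) Qb≡l′Q)))

      module _ {f : Series F} (f-supp : SupportedOnMultiples Q f) (j₀ : ℕ) (2+j₀<N : 2 ℕ.+ j₀ < N) where
        D A B M : ℕ
        D = Q ℕ.* (j₀ ℕ.+ N)
        A = Q ℕ.* suc j₀
        B = Q ℕ.* j₀
        M = Q ℕ.* (N ∸ 1)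

        D<2M : D < M ℕ.+ M
        D<2M = P.subst (D <_) (ℕP.*-distribˡ-+ Q (N ∸ 1) (N ∸ 1)) (ℕP.*-monoʳ-< Q (j₀+N<2[N∸1] N 2+j₀<N))
          where
          j₀+N<2[N∸1] : ∀ N → 2 ℕ.+ j₀ < N → j₀ ℕ.+ N < (N ∸ 1) ℕ.+ (N ∸ 1)
          j₀+N<2[N∸1] (suc N′) (s≤s 2+j₀≤N′) = P.subst (_< N′ ℕ.+ N′) (P.sym (ℕP.+-suc j₀ N′)) (ℕP.+-monoˡ-< N′ 2+j₀≤N′)

        weight : ℕ → Carrier
        weight l = monomial D l + (monomial A l * ι F (suc j₀) + monomial B l * ι F j₀)

        -- Below degree 2M, ψ^(l′Q) = X^(l′Q) (1 + l′ w), so only l ∈ {D, A, B} reach degree D.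
        compS-ψ-summand : ∀ l → l < suc D → f l * powS F ψ l D ≈ weight l * f l
        compS-ψ-summand l l<1+D with Q ∣? l
        ... | no Q∤l = trans (*-congʳ (f-supp l Q∤l)) (trans (zeroˡ _) (sym (trans (*-congˡ (f-supp l Q∤l)) (zeroʳ _))))
        ... | yes (divides l′ P.refl) = begin
          f l * powS F ψ (l′ ℕ.* Q) D                                   ≈⟨ *-congˡ (powS-ψ-coeff l′ D Ql′≤D r<2M) ⟩
          f l * (oneS F r + ι F l′ * w r)                               ≈⟨ *-congˡ (+-cong (𝟙≋monomial-0 r) (*-congˡ (w≋ r))) ⟩
          f l * (monomial 0 r + ι F l′ * (monomial ((N ∸ 1) ℕ.* Q) r + monomial (N ℕ.* Q) r))
            ≡⟨ P.cong (λ z → f l * (monomial 0 z + ι F l′ * (monomial ((N ∸ 1) ℕ.* Q) z + monomial (N ℕ.* Q) z))) r≡Qs ⟩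
          f l * (monomial 0 (Q ℕ.* s) + ι F l′ * (monomial ((N ∸ 1) ℕ.* Q) (Q ℕ.* s) + monomial (N ℕ.* Q) (Q ℕ.* s)))
            ≈⟨ *-congˡ (+-cong (monomial-index-shift l′ s 0 (j₀ ℕ.+ N) l′+s≡0+[j₀+N]) (trans (distribˡ _ _ _)
                 (+-cong (*-congˡ (monomial-index-shift l′ s (N ∸ 1) (suc j₀) l′+s≡[N∸1]+[1+j₀])) (*-congˡ (monomial-index-shift l′ s N j₀ l′+s≡N+j₀))))) ⟩
          f l * (monomial D l + (ι F l′ * monomial A l + ι F l′ * monomial B l))
            ≈⟨ *-congˡ (+-congˡ (+-cong (ι-*-monomial l′ (suc j₀)) (ι-*-monomial l′ j₀))) ⟩
          f l * weight l                                                 ≈⟨ *-comm _ _ ⟩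
          weight l * f l                                                 ∎
          where
          Ql′≤D : Q ℕ.* l′ ≤ D
          Ql′≤D = P.subst (_≤ D) (ℕP.*-comm l′ Q) (ℕP.≤-pred l<1+D)
          l′≤j₀+N : l′ ≤ j₀ ℕ.+ N
          l′≤j₀+N = ℕP.*-cancelˡ-≤ Q Ql′≤D
          s : ℕ
          s = j₀ ℕ.+ N ∸ l′
          r : ℕ
          r = D ∸ Q ℕ.* l′
          r≡Qs : r ≡ Q ℕ.* s
          r≡Qs = P.sym (ℕP.*-distribˡ-∸ Q (j₀ ℕ.+ N) l′)
          r<2M : r < M ℕ.+ M
          r<2M = ℕP.≤-<-trans (ℕP.m∸n≤m D (Q ℕ.* l′)) D<2M
          l′+s≡0+[j₀+N] : l′ ℕ.+ s ≡ 0 ℕ.+ (j₀ ℕ.+ N)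
          l′+s≡0+[j₀+N] = ℕP.m+[n∸m]≡n l′≤j₀+N
          l′+s≡N+j₀ : l′ ℕ.+ s ≡ N ℕ.+ j₀
          l′+s≡N+j₀ = P.trans l′+s≡0+[j₀+N] (ℕP.+-comm j₀ N)
          l′+s≡[N∸1]+[1+j₀] : l′ ℕ.+ s ≡ (N ∸ 1) ℕ.+ suc j₀
          l′+s≡[N∸1]+[1+j₀] = P.trans l′+s≡N+j₀ (P.trans (P.cong (ℕ._+ j₀) (P.sym (ℕP.m+[n∸m]≡n 1≤N))) (P.sym (ℕP.+-suc (N ∸ 1) j₀)))

        compS-ψ-coeff : compS F f ψ D ≈ f D + (ι F (suc j₀) * f A + ι F j₀ * f B)
        compS-ψ-coeff = begin
          Σ< (λ l → f l * powS F ψ l D) (suc D)           ≈⟨ sumLt-cong (suc D) compS-ψ-summand ⟩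
          Σ< (λ l → weight l * f l) (suc D)                ≈⟨ sumLt-cong (suc D) (λ l _ → spread l) ⟩
          Σ< (λ l → monomial D l * f l + (monomial A l * (ι F (suc j₀) * f l) + monomial B l * (ι F j₀ * f l))) (suc D)
            ≈⟨ trans (sumLt-+ _ _ (suc D)) (+-congˡ (sumLt-+ _ _ (suc D))) ⟩
          Σ< (λ l → monomial D l * f l) (suc D)
            + (Σ< (λ l → monomial A l * (ι F (suc j₀) * f l)) (suc D) + Σ< (λ l → monomial B l * (ι F j₀ * f l)) (suc D))
            ≈⟨ +-cong (sumLt-monomial D (suc D) f ℕP.≤-refl)
                      (+-cong (sumLt-monomial A (suc D) _ (s≤s A≤D)) (sumLt-monomial B (suc D) _ (s≤s (ℕP.≤-trans B≤A A≤D)))) ⟩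
          f D + (ι F (suc j₀) * f A + ι F j₀ * f B) ∎
          where
          B≤A : B ≤ A
          B≤A = ℕP.*-monoʳ-≤ Q (ℕP.n≤1+n j₀)
          A≤D : A ≤ D
          A≤D = ℕP.*-monoʳ-≤ Q (P.subst (_≤ j₀ ℕ.+ N) (ℕP.+-comm j₀ 1) (ℕP.+-monoʳ-≤ j₀ 1≤N))
          spread : ∀ l → weight l * f l ≈ monomial D l * f l + (monomial A l * (ι F (suc j₀) * f l) + monomial B l * (ι F j₀ * f l))
          spread l = trans (distribʳ _ _ _) (+-congˡ (trans (distribʳ _ _ _) (+-cong (*-assoc _ _ _) (*-assoc _ _ _))))

  ι-unit : ∀ {j} → ¬ p ∣ j → ∃ λ u → u * ι F j ≈ 1#
  ι-unit {j} p∤j with coprime-Bézout j⊥p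
    where
    j⊥p : Coprime j p
    j⊥p (d∣j , d∣p) with prime⇒irreducible pr d∣p
    ... | inj₁ d≡1  = d≡1
    ... | inj₂ P.refl = ⊥-elim (p∤j d∣j)
  ... | Bézout.+- x y 1+yp≡xj = ι F x , (begin
    ι F x * ι F j          ≈⟨ ι-* x j ⟨
    ι F (x ℕ.* j)          ≡⟨ P.cong (ι F) 1+yp≡xj ⟨
    1# + ι F (y ℕ.* p)     ≈⟨ trans (+-congˡ (ι-multiple (divides y P.refl))) (+-identityʳ _) ⟩
    1#                     ∎)
  ... | Bézout.-+ x y 1+xj≡yp = - ι F x , (begin
    - ι F x * ι F j        ≈⟨ -‿distribˡ-* (ι F x) (ι F j) ⟨
    - (ι F x * ι F j)      ≈⟨ -‿cong (+-inverseʳ-unique 1# _ 1+xj≈0) ⟩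
    - (- 1#)               ≈⟨ -‿involutive 1# ⟩
    1#                     ∎)
    where
    1+xj≈0 : 1# + ι F x * ι F j ≈ 0#
    1+xj≈0 = trans (+-congˡ (sym (ι-* x j))) (trans (reflexive (P.cong (ι F) 1+xj≡yp)) (ι-multiple (divides y P.refl)))

  ι-*-cancel : ∀ {j v} → ¬ p ∣ j → ι F j * v ≈ 0# → v ≈ 0#
  ι-*-cancel {j} {v} p∤j jv≈0 with ι-unit p∤j
  ... | u , uj≈1 = begin
    v                  ≈⟨ *-identityˡ v ⟨
    1# * v             ≈⟨ *-congʳ uj≈1 ⟨
    (u * ι F j) * v    ≈⟨ *-assoc _ _ _ ⟩
    u * (ι F j * v)    ≈⟨ *-congˡ jv≈0 ⟩
    u * 0#             ≈⟨ zeroʳ u ⟩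
    0#                 ∎

  recurrence⇒vanishing : ∀ (g : ℕ → Carrier) → (∀ j → ι F (suc j) * g (suc j) + ι F j * g j ≈ 0#) →
                         ∀ j → ¬ p ∣ j → g j ≈ 0#
  recurrence⇒vanishing g rec zero    p∤0   = ⊥-elim (p∤0 (divides 0 P.refl))
  recurrence⇒vanishing g rec (suc j) p∤1+j = ι-*-cancel p∤1+j (begin
    ι F (suc j) * g (suc j)                        ≈⟨ +-identityʳ _ ⟨
    ι F (suc j) * g (suc j) + 0#                   ≈⟨ +-congˡ previous ⟨
    ι F (suc j) * g (suc j) + ι F j * g j          ≈⟨ rec j ⟩
    0#                                             ∎)
    where
    previous : ι F j * g j ≈ 0#
    previous with p ∣? j
    ... | yes p∣j = trans (*-congʳ (ι-multiple p∣j)) (zeroˡ _)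
    ... | no  p∤j = trans (*-congˡ (recurrence⇒vanishing g rec j p∤j)) (zeroʳ _)

module PAdic {c ℓ} (F : Field c ℓ) (p : ℕ) (pr : Prime p) where
  open PrimePowers p pr
  open import Data.Fin using (Fin; toℕ; fromℕ<)
  open import Data.Fin.Properties using (toℕ-fromℕ<)
  open import Data.Nat.DivMod using (m%n%n≡m%n; m∣n⇒o%n%m≡o%m; %-remove-+ʳ)
  open import Data.Nat.Divisibility using (∣-trans; m∣m*n)
  open import Data.Nat using (_+_; _*_; _^_; _⊓_)

  Zₚ : Set
  Zₚ = Zp F p pr
  tr : ℕ → Zₚ → ℕ
  tr = trunc F p pr
  c⁻¹ : ℕ → Zₚ → ℕ → ℕ
  c⁻¹ = cinv F p pr

  trunc-extend : ∀ x s d → ∃ λ R → tr (s + d) x ≡ tr s x + p ^ s * R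
  trunc-extend x s zero    = 0 , P.trans (P.cong (λ z → tr z x) (ℕP.+-identityʳ s))
                                         (P.sym (P.trans (P.cong (tr s x +_) (ℕP.*-zeroʳ (p ^ s))) (ℕP.+-identityʳ _)))
  trunc-extend x s (suc d) with trunc-extend x s d
  ... | R , tr≡ = R + digit * p ^ d , (begin
    tr (s + suc d) x                                 ≡⟨ P.cong (λ z → tr z x) (ℕP.+-suc s d) ⟩
    tr (s + d) x + digit * p ^ (s + d)               ≡⟨ P.cong₂ (λ u v → u + digit * v) tr≡ (ℕP.^-distribˡ-+-* p s d) ⟩
    tr s x + p ^ s * R + digit * (p ^ s * p ^ d)     ≡⟨ regroup (tr s x) (p ^ s) R digit (p ^ d) ⟩
    tr s x + p ^ s * (R + digit * p ^ d)             ∎)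
    where
    open P.≡-Reasoning
    digit : ℕ
    digit = toℕ (x (s + d))
    regroup : ∀ a q R t u → a + q * R + t * (q * u) ≡ a + q * (R + t * u)
    regroup = solve-∀

  trunc-split : ∀ x {s r} → s ≤ r → ∃ λ R → tr r x ≡ tr s x + p ^ s * R
  trunc-split x {s} {r} s≤r = P.subst (λ z → ∃ λ R → tr z x ≡ tr s x + p ^ s * R) (ℕP.m+[n∸m]≡n s≤r) (trunc-extend x s (r ∸ s))

  trunc-agree : ∀ {x y i} → ValpDiffGe F p pr x y i → ∀ {s} → s ≤ i → tr s x ≡ tr s y
  trunc-agree x~y {zero}  _     = P.refl
  trunc-agree x~y {suc s} 1+s≤i = P.cong₂ (λ u d → u + toℕ d * p ^ s) (trunc-agree x~y (ℕP.<⇒≤ 1+s≤i)) (x~y s 1+s≤i)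

  cinv-congruent : ∀ k {x y i} → ValpDiffGe F p pr x y i → ∀ r →
                   c⁻¹ k x r %p^ (r ⊓ (k + i)) ≡ c⁻¹ k y r %p^ (r ⊓ (k + i))
  cinv-congruent k {x} {y} {i} x~y r = begin
    c⁻¹ k x r %p^ e                   ≡⟨ drop-outer x ⟩
    (1 + p ^ k * tr r x) %p^ e        ≡⟨ agree ⟩
    (1 + p ^ k * tr r y) %p^ e        ≡⟨ drop-outer y ⟨
    c⁻¹ k y r %p^ e                   ∎
    where
    open P.≡-Reasoning
    e : ℕ
    e = r ⊓ (k + i)
    instance
      p^e-nonZero : NonZero (p ^ e)
      p^e-nonZero = ℕP.m^n≢0 p e
      p^r-nonZero : NonZero (p ^ r)
      p^r-nonZero = ℕP.m^n≢0 p r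
    drop-outer : ∀ z → c⁻¹ k z r %p^ e ≡ (1 + p ^ k * tr r z) %p^ e
    drop-outer z = m∣n⇒o%n%m≡o%m (p ^ e) (p ^ r) _ (p^m∣p^n p (ℕP.m⊓n≤m r (k + i)))
    cut : i ≤ r → ∀ z → (1 + p ^ k * tr r z) %p^ e ≡ (1 + p ^ k * tr i z) %p^ e
    cut i≤r z with trunc-split z i≤r
    ... | R , tr≡ = begin
      (1 + p ^ k * tr r z) %p^ e                        ≡⟨ P.cong (λ t → (1 + p ^ k * t) %p^ e) tr≡ ⟩
      (1 + p ^ k * (tr i z + p ^ i * R)) %p^ e          ≡⟨ P.cong (_%p^ e) (regroup (p ^ k) (tr i z) (p ^ i) R) ⟩
      (1 + p ^ k * tr i z + p ^ k * p ^ i * R) %p^ e    ≡⟨ %-remove-+ʳ _ (∣-trans p^e∣p^k*p^i (m∣m*n R)) ⟩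
      (1 + p ^ k * tr i z) %p^ e                        ∎
      where
      regroup : ∀ a b q R → 1 + a * (b + q * R) ≡ 1 + a * b + a * q * R
      regroup = solve-∀
      p^e∣p^k*p^i : p ^ e ∣ p ^ k * p ^ i
      p^e∣p^k*p^i = P.subst (p ^ e ∣_) (ℕP.^-distribˡ-+-* p k i) (p^m∣p^n p (ℕP.m⊓n≤n r (k + i)))
    agree : (1 + p ^ k * tr r x) %p^ e ≡ (1 + p ^ k * tr r y) %p^ e
    agree with ℕP.≤-total r i
    ... | inj₁ r≤i = P.cong (λ t → (1 + p ^ k * t) %p^ e) (trunc-agree x~y r≤i)
    ... | inj₂ i≤r = P.trans (cut i≤r x)
                       (P.trans (P.cong (λ t → (1 + p ^ k * t) %p^ e) (trunc-agree x~y ℕP.≤-refl)) (P.sym (cut i≤r y)))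

  digit0 digit1 : Fin p
  digit0 = fromℕ< (ℕP.<-trans (s≤s z≤n) 1<p)
  digit1 = fromℕ< 1<p

  toℕ-digit0 : toℕ digit0 ≡ 0
  toℕ-digit0 = toℕ-fromℕ< _

  toℕ-digit1 : toℕ digit1 ≡ 1
  toℕ-digit1 = toℕ-fromℕ< _

  0ₚ : Zₚ
  0ₚ _ = digit0

  p^ₚ : ℕ → Zₚ
  p^ₚ i t with t ℕ.≟ i
  ... | yes _ = digit1
  ... | no  _ = digit0

  0ₚ~p^ₚ : ∀ i → ValpDiffGe F p pr 0ₚ (p^ₚ i) i
  0ₚ~p^ₚ i t t<i with t ℕ.≟ i
  ... | yes P.refl = ⊥-elim (ℕP.<-irrefl P.refl t<i)
  ... | no  _      = P.refl

  trunc-0ₚ : ∀ r → tr r 0ₚ ≡ 0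
  trunc-0ₚ zero    = P.refl
  trunc-0ₚ (suc r) = P.cong₂ (λ u d → u + d * p ^ r) (trunc-0ₚ r) toℕ-digit0

  trunc-p^ₚ-≤ : ∀ i {r} → r ≤ i → tr r (p^ₚ i) ≡ 0
  trunc-p^ₚ-≤ i {zero}  _     = P.refl
  trunc-p^ₚ-≤ i {suc r} 1+r≤i with r ℕ.≟ i
  ... | yes P.refl = ⊥-elim (ℕP.<-irrefl P.refl 1+r≤i)
  ... | no  _      = P.cong₂ (λ u d → u + d * p ^ r) (trunc-p^ₚ-≤ i (ℕP.<⇒≤ 1+r≤i)) toℕ-digit0

  trunc-p^ₚ-> : ∀ i {r} → i < r → tr r (p^ₚ i) ≡ p ^ i
  trunc-p^ₚ-> i {suc r} i<1+r with r ℕ.≟ i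
  ... | yes P.refl = P.trans (P.cong₂ (λ u d → u + d * p ^ r) (trunc-p^ₚ-≤ r ℕP.≤-refl) toℕ-digit1) (ℕP.*-identityˡ _)
  ... | no  r≢i    = P.trans (P.cong₂ (λ u d → u + d * p ^ r) (trunc-p^ₚ-> i (ℕP.≤∧≢⇒< (ℕP.≤-pred i<1+r) (r≢i ∘ P.sym))) toℕ-digit0)
                             (ℕP.+-identityʳ _)

  cinv-0ₚ : ∀ k r → c⁻¹ k 0ₚ r %p^ r ≡ 1 %p^ r
  cinv-0ₚ k r = P.trans (m%n%n≡m%n _ (p ^ r) {{ℕP.m^n≢0 p r}})
    (P.trans (P.cong (λ t → (1 + p ^ k * t) %p^ r) (trunc-0ₚ r)) (P.cong (λ t → suc t %p^ r) (ℕP.*-zeroʳ (p ^ k))))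

  cinv-p^ₚ : ∀ k i r → c⁻¹ k (p^ₚ i) r %p^ r ≡ suc (p ^ (k + i)) %p^ r
  cinv-p^ₚ k i r = P.trans (m%n%n≡m%n _ (p ^ r)) cases
    where
    instance
      p^r-nonZero : NonZero (p ^ r)
      p^r-nonZero = ℕP.m^n≢0 p r
    cases : (1 + p ^ k * tr r (p^ₚ i)) %p^ r ≡ suc (p ^ (k + i)) %p^ r
    cases with r ℕ.≤? i
    ... | yes r≤i = P.trans (P.cong (λ t → suc (p ^ k * t) %p^ r) (trunc-p^ₚ-≤ i r≤i))
                    (P.trans (P.cong (λ t → suc t %p^ r) (ℕP.*-zeroʳ (p ^ k)))
                    (P.sym (%-remove-+ʳ 1 (p^m∣p^n p (ℕP.≤-trans r≤i (ℕP.m≤n+m i k))))))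
    ... | no  r≰i = P.cong (λ t → suc t %p^ r)
                    (P.trans (P.cong (p ^ k *_) (trunc-p^ₚ-> i (ℕP.≰⇒> r≰i))) (P.sym (ℕP.^-distribˡ-+-* p k i)))

module Rationals where
  open import Data.Nat using (_+_; _*_; pred)
  open import Data.Integer as ℤ using (+_; -[1+_]; ∣_∣)
  import Data.Integer.Properties as ℤP
  import Data.Integer.GCD as ℤGCD
  open import Data.Integer.Tactic.RingSolver using () renaming (solve-∀ to ℤ-solve-∀)
  open import Data.Rational as ℚ using (toℚᵘ)
  import Data.Rational.Properties as ℚP
  open import Data.Rational.Unnormalised as ℚᵘ using (mkℚᵘ; *≡*; *<*)

  toℚᵘ-/ : ∀ i d .{{_ : NonZero d}} → toℚᵘ (i ℚ./ d) ℚᵘ.≃ mkℚᵘ i (pred d)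
  toℚᵘ-/ i d = *≡* (begin
    ℚᵘ.↥ (toℚᵘ q) ℤ.* + suc (pred d)   ≡⟨ P.cong₂ ℤ._*_ (ℚP.↥ᵘ-toℚᵘ q) (P.cong +_ (ℕP.suc-pred d)) ⟩
    ℚ.↥ q ℤ.* + d                      ≡⟨ P.cong (ℚ.↥ q ℤ.*_) (ℚP.↧-/ i d) ⟨
    ℚ.↥ q ℤ.* (ℚ.↧ q ℤ.* g)            ≡⟨ swap (ℚ.↥ q) (ℚ.↧ q) g ⟩
    (ℚ.↥ q ℤ.* g) ℤ.* ℚ.↧ q            ≡⟨ P.cong (ℤ._* ℚ.↧ q) (ℚP.↥-/ i d) ⟩
    i ℤ.* ℚ.↧ q                        ≡⟨ P.cong (i ℤ.*_) (ℚP.↧ᵘ-toℚᵘ q) ⟨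
    i ℤ.* ℚᵘ.↧ (toℚᵘ q)                ∎)
    where
    open P.≡-Reasoning
    q : ℚ.ℚ
    q = i ℚ./ d
    g : ℤ.ℤ
    g = ℤGCD.gcd i (+ d)
    swap : ∀ a b g → a ℤ.* (b ℤ.* g) ≡ (a ℤ.* g) ℤ.* b
    swap = ℤ-solve-∀

  mkℚᵘ-*-≃ : ∀ a A b c C .{{_ : NonZero A}} .{{_ : NonZero C}} → a * b * C ≡ c * A →
             mkℚᵘ (+ a) (pred A) ℚᵘ.* mkℚᵘ (+ b) 0 ℚᵘ.≃ mkℚᵘ (+ c) (pred C)
  mkℚᵘ-*-≃ a A b c C abC≡cA = *≡* (begin
    (+ a ℤ.* + b) ℤ.* + suc (pred C)          ≡⟨ P.cong₂ ℤ._*_ (P.sym (ℤP.pos-* a b)) (P.cong +_ (ℕP.suc-pred C)) ⟩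
    + (a * b) ℤ.* + C                         ≡⟨ ℤP.pos-* (a * b) C ⟨
    + (a * b * C)                             ≡⟨ P.cong +_ abC≡cA ⟩
    + (c * A)                                 ≡⟨ ℤP.pos-* c A ⟩
    + c ℤ.* + A                               ≡⟨ P.cong (λ z → + c ℤ.* + z) (P.trans (P.cong suc (ℕP.*-identityʳ (pred A))) (ℕP.suc-pred A)) ⟨
    + c ℤ.* + suc (pred A * 1)                ∎)
    where
    open P.≡-Reasoning

  mkℚᵘ-<⇒ : ∀ a A c C .{{_ : NonZero A}} .{{_ : NonZero C}} → mkℚᵘ (+ a) (pred A) ℚᵘ.< mkℚᵘ (+ c) (pred C) → a * C < c * A
  mkℚᵘ-<⇒ a A c C (*<* lt) = P.subst₂ _<_ (P.cong (a *_) (ℕP.suc-pred C)) (P.cong (c *_) (ℕP.suc-pred A))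
    (ℤP.drop‿+<+ (P.subst₂ ℤ._<_ (P.sym (ℤP.pos-* a _)) (P.sym (ℤP.pos-* c _)) lt))

  mkℚᵘ-<-+ : ∀ D m′ Q n′ a b′ → D * suc n′ + ∣ a ∣ * suc n′ * suc m′ < Q * suc m′ →
             mkℚᵘ (+ D) m′ ℚᵘ.< mkℚᵘ (+ Q) n′ ℚᵘ.+ mkℚᵘ a b′
  mkℚᵘ-<-+ D m′ Q n′ (+ u) b′ h = *<* (P.subst₂ ℤ._<_ (ℤP.pos-* D (suc n′ * suc b′)) rhs (ℤ.+<+ main))
    where
    D*N<Q*M : D * suc n′ < Q * suc m′
    D*N<Q*M = ℕP.≤-<-trans (ℕP.m≤m+n (D * suc n′) _) h
    main : D * (suc n′ * suc b′) < (Q * suc b′ + u * suc n′) * suc m′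
    main = ℕP.<-≤-trans (P.subst (_< Q * suc m′ * suc b′) (ℕP.*-assoc D (suc n′) (suc b′)) (ℕP.*-monoˡ-< (suc b′) D*N<Q*M))
             (P.subst (_≤ (Q * suc b′ + u * suc n′) * suc m′) (swap Q (suc m′) (suc b′)) (ℕP.*-monoˡ-≤ (suc m′) (ℕP.m≤m+n (Q * suc b′) (u * suc n′))))
      where
      swap : ∀ Q M B → Q * B * M ≡ Q * M * B
      swap = solve-∀
    rhs : + ((Q * suc b′ + u * suc n′) * suc m′) ≡ (+ Q ℤ.* + suc b′ ℤ.+ + u ℤ.* + suc n′) ℤ.* + suc m′
    rhs = P.trans (ℤP.pos-* (Q * suc b′ + u * suc n′) (suc m′))
            (P.cong (ℤ._* + suc m′) (P.cong₂ ℤ._+_ (ℤP.pos-* Q (suc b′)) (ℤP.pos-* u (suc n′))))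
  mkℚᵘ-<-+ D m′ Q n′ -[1+ u ] b′ h = *<* (P.subst₂ ℤ._<_ (ℤP.pos-* D (suc n′ * suc b′)) rhs (ℤ.+<+ main))
    where
    T : ℕ
    T = suc u * suc n′
    hB : D * suc n′ * suc b′ + T * suc m′ < Q * suc b′ * suc m′
    hB = ℕP.≤-<-trans (P.subst (_≤ (D * suc n′ + T * suc m′) * suc b′) (P.cong (λ z → D * suc n′ * suc b′ + z) (ℕP.*-identityʳ (T * suc m′)))
                        (P.subst (D * suc n′ * suc b′ + T * suc m′ * 1 ≤_) (P.sym (ℕP.*-distribʳ-+ (suc b′) (D * suc n′) (T * suc m′)))
                          (ℕP.+-monoʳ-≤ (D * suc n′ * suc b′) (ℕP.*-monoʳ-≤ (T * suc m′) (s≤s z≤n)))))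
           (P.subst ((D * suc n′ + T * suc m′) * suc b′ <_) (swap Q (suc m′) (suc b′)) (ℕP.*-monoˡ-< (suc b′) h))
      where
      swap : ∀ Q M B → Q * M * B ≡ Q * B * M
      swap = solve-∀
    T≤PB : T ≤ Q * suc b′
    T≤PB = ℕP.<⇒≤ (ℕP.*-cancelʳ-< (suc m′) T (Q * suc b′) (ℕP.≤-<-trans (ℕP.m≤n+m (T * suc m′) _) hB))
    main : D * (suc n′ * suc b′) < (Q * suc b′ ∸ T) * suc m′
    main = P.subst₂ _<_ (ℕP.*-assoc D (suc n′) (suc b′)) (P.sym (ℕP.*-distribʳ-∸ (suc m′) (Q * suc b′) T))
             (ℕP.m+n≤o⇒m≤o∸n (suc (D * suc n′ * suc b′)) hB)
    rhs : + ((Q * suc b′ ∸ T) * suc m′) ≡ (+ Q ℤ.* + suc b′ ℤ.+ -[1+ u ] ℤ.* + suc n′) ℤ.* + suc m′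
    rhs = P.trans (ℤP.pos-* (Q * suc b′ ∸ T) (suc m′))
            (P.cong (ℤ._* + suc m′) (P.trans (P.sym (ℤP.⊖-≥ T≤PB)) (P.cong (ℤ._+ -[1+ u ] ℤ.* + suc n′) (ℤP.pos-* Q (suc b′)))))

module ValuationBounds {c ℓ} (F : Field c ℓ) (p : ℕ) (pr : Prime p) where
  open PrimePowers p pr
  open Rationals
  open import Data.Nat using (_+_; _*_; _^_; pred)
  open import Data.Integer as ℤ using (+_; -[1+_]; ∣_∣)
  import Data.Integer.Properties as ℤP
  open import Data.Rational as ℚ using (mkℚ; toℚᵘ)
  import Data.Rational.Properties as ℚP
  open import Data.Rational.Unnormalised as ℚᵘ using (mkℚᵘ)
  import Data.Rational.Unnormalised.Properties as ℚᵘP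

  pp : ℤ.ℤ → ℚ.ℚ
  pp = ppow F p pr

  toℚᵘ-ppow-+ : ∀ m → toℚᵘ (pp (+ m)) ℚᵘ.≃ mkℚᵘ (+ (p ^ m)) 0
  toℚᵘ-ppow-+ m = toℚᵘ-/ (+ (p ^ m)) 1

  ppow[k-n]*ppow[i]≃ : ∀ k n i → toℚᵘ (pp (+ k ℤ.- + n) ℚ.* pp (+ i)) ℚᵘ.≃ mkℚᵘ (+ (p ^ (k + i))) (pred (p ^ n))
  ppow[k-n]*ppow[i]≃ k n i = ℚᵘP.≃-trans (ℚP.toℚᵘ-homo-* (pp (+ k ℤ.- + n)) (pp (+ i))) ([ nonnegative , negative ]′ (ℕP.≤-total n k))
    where
    open P.≡-Reasoning
    instance
      p^n-nonZero : NonZero (p ^ n)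
      p^n-nonZero = ℕP.m^n≢0 p n
    Goal : Set
    Goal = toℚᵘ (pp (+ k ℤ.- + n)) ℚᵘ.* toℚᵘ (pp (+ i)) ℚᵘ.≃ mkℚᵘ (+ (p ^ (k + i))) (pred (p ^ n))
    nonnegative : n ≤ k → Goal
    nonnegative n≤k = ℚᵘP.≃-trans (ℚᵘP.*-cong first (toℚᵘ-ppow-+ i)) (mkℚᵘ-*-≃ (p ^ (k ∸ n)) 1 (p ^ i) _ (p ^ n) exponents)
      where
      first : toℚᵘ (pp (+ k ℤ.- + n)) ℚᵘ.≃ mkℚᵘ (+ (p ^ (k ∸ n))) 0
      first = P.subst (λ z → toℚᵘ (pp z) ℚᵘ.≃ mkℚᵘ (+ (p ^ (k ∸ n))) 0) (P.sym (P.trans (ℤP.m-n≡m⊖n k n) (ℤP.⊖-≥ n≤k))) (toℚᵘ-ppow-+ (k ∸ n))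
      exponents : p ^ (k ∸ n) * p ^ i * p ^ n ≡ p ^ (k + i) * 1
      exponents = begin
        p ^ (k ∸ n) * p ^ i * p ^ n     ≡⟨ P.cong (_* p ^ n) (ℕP.^-distribˡ-+-* p (k ∸ n) i) ⟨
        p ^ (k ∸ n + i) * p ^ n         ≡⟨ ℕP.^-distribˡ-+-* p (k ∸ n + i) n ⟨
        p ^ (k ∸ n + i + n)             ≡⟨ P.cong (p ^_) (regroup (k ∸ n) i n) ⟩
        p ^ (k ∸ n + n + i)             ≡⟨ P.cong (λ z → p ^ (z + i)) (ℕP.m∸n+n≡m n≤k) ⟩
        p ^ (k + i)                     ≡⟨ ℕP.*-identityʳ _ ⟨
        p ^ (k + i) * 1                 ∎
        where
        regroup : ∀ a b c → a + b + c ≡ a + c + b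
        regroup = solve-∀
    negative : k ≤ n → Goal
    negative k≤n with n ∸ k in n∸k≡
    ... | zero  = nonnegative (ℕP.m∸n≡0⇒m≤n n∸k≡)
    ... | suc j = ℚᵘP.≃-trans (ℚᵘP.*-cong first (toℚᵘ-ppow-+ i))
                              (mkℚᵘ-*-≃ 1 (p ^ suc j) (p ^ i) _ (p ^ n) {{ℕP.m^n≢0 p (suc j)}} exponents)
      where
      first : toℚᵘ (pp (+ k ℤ.- + n)) ℚᵘ.≃ mkℚᵘ (+ 1) (pred (p ^ suc j))
      first = P.subst (λ z → toℚᵘ (pp z) ℚᵘ.≃ mkℚᵘ (+ 1) (pred (p ^ suc j))) (P.sym k-n≡-[1+j])
                      (toℚᵘ-/ (+ 1) (p ^ suc j) {{ℕP.m^n≢0 p (suc j)}})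
        where
        k-n≡-[1+j] : + k ℤ.- + n ≡ -[1+ j ]
        k-n≡-[1+j] = P.trans (ℤP.m-n≡m⊖n k n) (P.trans (ℤP.⊖-≤ k≤n) (P.cong (λ z → ℤ.- (+ z)) n∸k≡))
      j+1+k≡n : suc j + k ≡ n
      j+1+k≡n = P.trans (P.cong (_+ k) (P.sym n∸k≡)) (ℕP.m∸n+n≡m k≤n)
      exponents : 1 * p ^ i * p ^ n ≡ p ^ (k + i) * p ^ suc j
      exponents = begin
        1 * p ^ i * p ^ n       ≡⟨ P.cong (_* p ^ n) (ℕP.*-identityˡ (p ^ i)) ⟩
        p ^ i * p ^ n           ≡⟨ ℕP.^-distribˡ-+-* p i n ⟨
        p ^ (i + n)             ≡⟨ P.cong (λ z → p ^ (i + z)) j+1+k≡n ⟨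
        p ^ (i + (suc j + k))   ≡⟨ P.cong (p ^_) (regroup i (suc j) k) ⟩
        p ^ (k + i + suc j)     ≡⟨ ℕP.^-distribˡ-+-* p (k + i) (suc j) ⟩
        p ^ (k + i) * p ^ suc j ∎
        where
        regroup : ∀ a b c → a + (b + c) ≡ c + a + b
        regroup = solve-∀

  below-bound⇒ : ∀ k n i m j → (+ j ℚ./ p ^ m) {{ℕP.m^n≢0 p m}} ℚ.< pp (+ k ℤ.- + n) ℚ.* pp (+ i) ℚ.+ ℚ.0ℚ →
                 j * p ^ n < p ^ (k + i) * p ^ m
  below-bound⇒ k n i m j x<R+0 = mkℚᵘ-<⇒ j (p ^ m) (p ^ (k + i)) (p ^ n) {{ℕP.m^n≢0 p m}} {{ℕP.m^n≢0 p n}}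
    (ℚᵘP.<-respʳ-≃ (ppow[k-n]*ppow[i]≃ k n i) (ℚᵘP.<-respˡ-≃ (toℚᵘ-/ (+ j) (p ^ m) {{ℕP.m^n≢0 p m}})
      (ℚP.toℚᵘ-mono-< (P.subst (_ ℚ.<_) (ℚP.+-identityʳ _) x<R+0))))

  ⇒below-bound : ∀ k n i m j μ → j * p ^ n + ∣ ℚ.↥ μ ∣ * p ^ n * p ^ m < p ^ (k + i) * p ^ m →
                 (+ j ℚ./ p ^ m) {{ℕP.m^n≢0 p m}} ℚ.< pp (+ k ℤ.- + n) ℚ.* pp (+ i) ℚ.+ μ
  ⇒below-bound k n i m j μ@(mkℚ a b′ _) h =
    ℚP.toℚᵘ-cancel-< (ℚᵘP.<-respʳ-≃ bound≃ (ℚᵘP.<-respˡ-≃ (ℚᵘP.≃-sym (toℚᵘ-/ (+ j) (p ^ m) {{ℕP.m^n≢0 p m}})) core))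
    where
    R : ℚ.ℚ
    R = pp (+ k ℤ.- + n) ℚ.* pp (+ i)
    bound≃ : mkℚᵘ (+ (p ^ (k + i))) (pred (p ^ n)) ℚᵘ.+ mkℚᵘ a b′ ℚᵘ.≃ toℚᵘ (R ℚ.+ μ)
    bound≃ = ℚᵘP.≃-sym (ℚᵘP.≃-trans (ℚP.toℚᵘ-homo-+ R μ) (ℚᵘP.+-congˡ (mkℚᵘ a b′) (ppow[k-n]*ppow[i]≃ k n i)))
    core : mkℚᵘ (+ j) (pred (p ^ m)) ℚᵘ.< mkℚᵘ (+ (p ^ (k + i))) (pred (p ^ n)) ℚᵘ.+ mkℚᵘ a b′
    core = mkℚᵘ-<-+ j _ (p ^ (k + i)) _ a b′
      (P.subst₂ (λ u v → j * u + ∣ a ∣ * u * v < p ^ (k + i) * v)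
        (P.sym (ℕP.suc-pred _ {{ℕP.m^n≢0 p n}})) (P.sym (ℕP.suc-pred _ {{ℕP.m^n≢0 p m}})) h)

module Characterisation {c ℓ} (F : Field c ℓ) (p : ℕ) (pr : Prime p) (char : HasChar F p) where
  open Field F
  open PowerSeries F
  open PrimePowers p pr
  open CharacteristicP F p pr char
  open PAdic F p pr
  open ValuationBounds F p pr using (below-bound⇒; ⇒below-bound)
  open import Algebra.Properties.Ring ring using (x≈y⇒x∙y⁻¹≈ε; x∙y⁻¹≈ε⇒x≈y; +-cancelˡ)
  open import Data.Integer as ℤ using (+_)
  import Data.Rational as ℚ
  open import Relation.Binary.Reasoning.Setoid setoid

  InE⇔supported : ∀ n f → InE F p pr n f ⇔ SupportedOnMultiples (p ℕ.^ (level f ∸ n)) (coeff f)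
  InE⇔supported n f = mk⇔
    (λ inE l p^d∤l → inE l (p^d∤l ∘ Equivalence.to (p^m∣l*p^n⇔p^[m∸n]∣l p (level f) n l)))
    (λ supp l p^m∤lp^n → supp l (p^m∤lp^n ∘ Equivalence.from (p^m∣l*p^n⇔p^[m∸n]∣l p (level f) n l)))

  InE⇒InSh : ∀ k n f → InE F p pr n f → InSh F p pr k (+ k ℤ.- + n) f
  InE⇒InSh k n f inE = ℚ.0ℚ , λ x y i x~y j j<bound → x≈y⇒x∙y⁻¹≈ε
    (actS-cong-≈[<] (m ∸ n) (Equivalence.to (InE⇔supported n f) inE) (φ-cong-≈[<] (k ℕ.+ i) (cinv-congruent k x~y))
      j (l*p^n<a*p^m⇒l<p^[m∸n]*a p m n j _ (below-bound⇒ k n i m j j<bound)))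
    where
    m : ℕ
    m = level f

  module _ (k n : ℕ) (f : Einf F) (sh : InSh F p pr k (+ k ℤ.- + n) f) where
    m : ℕ
    m = level f
    s : Series F
    s = coeff f

    -- Compare x = 0, which acts trivially, with y = p^i for i so large that
    -- degree D lies below the shift bound.
    InSh⇒recurrence : ∀ e → e ℕ.+ n < m → SupportedOnMultiples (p ℕ.^ e) s →
                      ∀ j₀ → ι F (suc j₀) * s (p ℕ.^ e ℕ.* suc j₀) + ι F j₀ * s (p ℕ.^ e ℕ.* j₀) ≈ 0#
    InSh⇒recurrence e e+n<m supp j₀ = +-cancelˡ (s D) _ _ (begin
      s D + R            ≈⟨ compS-ψ-coeff e supp j₀ 2+j₀<N ⟨
      actS F t s D       ≈⟨ x∙y⁻¹≈ε⇒x≈y _ _ difference≈0 ⟨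
      actS F t₀ s D      ≈⟨ trans (compS-cong s (φ-identity (cinv-0ₚ k)) D) (compS-X s D) ⟩
      s D                ≈⟨ +-identityʳ (s D) ⟨
      s D + 0#           ∎)
      where
      μ : ℚ.ℚ
      μ = proj₁ sh
      c′ : ℕ
      c′ = ℤ.∣ ℚ.↥ μ ∣ ℕ.* p ℕ.^ n ℕ.* p ℕ.^ m
      i : ℕ
      i = 3 ℕ.+ (j₀ ℕ.+ c′)
      N : ℕ
      N = p ℕ.^ (k ℕ.+ i)
      D : ℕ
      D = p ℕ.^ e ℕ.* (j₀ ℕ.+ N)
      t₀ : ℕ → ℕ
      t₀ = c⁻¹ k 0ₚ
      t : ℕ → ℕ
      t = c⁻¹ k (p^ₚ i)
      R : Carrier
      R = ι F (suc j₀) * s (p ℕ.^ e ℕ.* suc j₀) + ι F j₀ * s (p ℕ.^ e ℕ.* j₀)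
      open Unipotent (k ℕ.+ i) t (cinv-p^ₚ k i) using (compS-ψ-coeff)
      2+j₀<N : 2 ℕ.+ j₀ < N
      2+j₀<N = proj₁ (large-shift 1<p k e n e+n<m j₀ c′)
      within-bound : D ℕ.* p ℕ.^ n ℕ.+ c′ < N ℕ.* p ℕ.^ m
      within-bound = proj₂ (large-shift 1<p k e n e+n<m j₀ c′)
      difference≈0 : actS F t₀ s D - actS F t s D ≈ 0#
      difference≈0 = proj₂ sh 0ₚ (p^ₚ i) i (0ₚ~p^ₚ i) D (⇒below-bound k n i m D μ within-bound)

    InSh⇒supported : ∀ e → e ≤ m ∸ n → SupportedOnMultiples (p ℕ.^ e) s
    InSh⇒supported zero    _       l 1∤l = ⊥-elim (1∤l (1∣ l))
    InSh⇒supported (suc e) 1+e≤m-n l p^[1+e]∤l with p ℕ.^ e ∣? l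
    ... | no p^e∤l = InSh⇒supported e (ℕP.<⇒≤ 1+e≤m-n) l p^e∤l
    ... | yes (divides q P.refl) with p ∣? q
    ...   | yes (divides r P.refl) = ⊥-elim (p^[1+e]∤l (divides r (ℕP.*-assoc r p (p ℕ.^ e))))
    ...   | no p∤q = trans (reflexive (P.cong s (ℕP.*-comm q (p ℕ.^ e))))
                       (recurrence⇒vanishing (λ j → s (p ℕ.^ e ℕ.* j))
                         (InSh⇒recurrence e (m<o∸n⇒m+n<o e n m 1+e≤m-n) (InSh⇒supported e (ℕP.<⇒≤ 1+e≤m-n))) q p∤q)

  InSh⇒InE : ∀ k n f → InSh F p pr k (+ k ℤ.- + n) f → InE F p pr n f
  InSh⇒InE k n f sh = Equivalence.from (InE⇔supported n f) (InSh⇒supported k n f sh (level f ∸ n) ℕP.≤-refl)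

open import Data.Integer using (+_; _-_)

-- The hypotheses on k are the paper's standing assumptions on Γ_k; the argument only
-- uses the formula for c⁻¹.
corollary2p5 : ∀ {c ℓ} (E : Field c ℓ) (p : ℕ) (pr : Prime p) → HasChar E p →
    (k : ℕ) → 1 ≤ k → (p ≡ 2 → 2 ≤ k) →
    (n : ℕ) (f : Einf E) →
    InSh E p pr k (+ k - + n) f ⇔ InE E p pr n f
corollary2p5 E p pr char k _ _ n f = mk⇔ (InSh⇒InE k n f) (InE⇒InSh k n f)
  where open Characterisation E p pr char
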